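{- Let $k\ge1$ be an integer and let $T^*_k(z)=\sum_{i\ge 0}|\mathcal{M}^*_{F_{k,i}}|\,z^i$ be the generating function of grand $k$-Fibonacci paths by length. Then, as formal power series, \[ T_k^*(z)=\frac{1-kz-z^2}{\sqrt{(1-(k+1)z-z^2)^2-4z^2(1-kz-z^2)^2}} =\cfrac{1}{1-\frac{z}{1-kz-z^2} - \cfrac{2z^2}{1-\frac{z}{1-kz-z^2}-\cfrac{z^2}{1-\frac{z}{1-kz-z^2}-\cfrac{z^2}{\ddots}}}}, \] and for every integer $t\ge1$, \[ [z^t]\,T_k^*(z)=F_{k+1,t}^{(1)} + \sum_{n=1}^{t}\sum_{m=0}^{t}\sum_{l=0}^{t-2n-2m}2^n\frac{n}{n+2m}\binom{n+2m}{m}\binom{l+2n+2m}{l}F_{k,t-2n-2m-l+1}^{(l)} . \]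
   Context: For a positive integer $k$, the $k$-Fibonacci numbers are defined by $F_{k,0}=0$, $F_{k,1}=1$, $F_{k,n+1}=kF_{k,n}+F_{k,n-1}$ for $n\ge1$. A grand $k$-Fibonacci path of length $n$ is a lattice path in $\mathbb{Z}\times\mathbb{Z}$ from $(0,0)$ to $(n,0)$ (with no restriction on going below the $x$-axis), built from rise steps $U=(1,1)$, fall steps $D=(1,-1)$, and horizontal steps $H_l=(l,0)$ for any positive integer $l$, where each step $H_l$ is additionally assigned one of $F_{k,l}$ colors (differently colored paths are counted as different). $\mathcal{M}^*_{F_{k,n}}$ denotes the set of such colored paths of length $n$; the empty path is the unique one of length $0$. The convolved $k$-Fibonacci numbers $F^{(r)}_{k,j}$ (for integers $r\ge0$, $j\ge1$, and any positive integer $k$) are defined by $(1-kx-x^2)^{ -r}=\sum_{j\ge0}F^{(r)}_{k,j+1}x^j$ (so $F^{(0)}_{k,1}=1$, $F^{(0)}_{k,j}=0$ for $j\ge2$); sums whose upper limit is smaller than the lower limit are empty. The square root denotes the formal power series square root with constant term $1$, and the infinite continued fraction is the limit (in the formal power series topology) of its finite truncations. -}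

module Defs where

open import Data.Nat as ℕ using (ℕ; zero; suc; _≤_; _≤ᵇ_)
open import Data.Nat.Combinatorics using (_C_)
open import Data.Integer as ℤ using (ℤ; +_)
open import Data.Rational as ℚ using (ℚ; 0ℚ; 1ℚ; _+_; _*_; _-_; -_; _/_; 1/_; ≢-nonZero)
open import Data.Rational.Properties using (_≟_)
open import Data.Fin using (Fin)
open import Data.List using (List; []; _∷_; map; zipWith; upTo; foldr)
open import Data.Bool using (if_then_else_)
open import Data.Product using (Σ; _×_; ∃-syntax)
open import Relation.Nullary using (yes; no)
open import Relation.Binary.PropositionalEquality using (_≡_)

F : ℕ → ℕ → ℕ
F k zero = zero
F k (suc zero) = suc zero
F k (suc (suc n)) = k ℕ.* F k (suc n) ℕ.+ F k n

-- Steps: U=(1,1), D=(1,-1), H_l=(l,0) (l ≥ 1) carrying one of F_{k,l} colours.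
-- The constructor  H l c  represents the horizontal step of length  suc l.
data Step (k : ℕ) : Set where
  U : Step k
  D : Step k
  H : (l : ℕ) → Fin (F k (suc l)) → Step k

stepLength : ∀ {k} → Step k → ℕ
stepLength U = 1
stepLength D = 1
stepLength (H l _) = suc l

stepHeight : ∀ {k} → Step k → ℤ
stepHeight U = + 1
stepHeight D = ℤ.- (+ 1)
stepHeight (H _ _) = + 0

pathLength : ∀ {k} → List (Step k) → ℕ
pathLength [] = 0
pathLength (s ∷ ss) = stepLength s ℕ.+ pathLength ss

pathHeight : ∀ {k} → List (Step k) → ℤ
pathHeight [] = + 0
pathHeight (s ∷ ss) = stepHeight s ℤ.+ pathHeight ss

GrandPath : ℕ → ℕ → Set
GrandPath k n = Σ (List (Step k)) (λ s → (pathLength s ≡ n) × (pathHeight s ≡ + 0))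

PS : Set
PS = ℕ → ℚ

_≈ₚ_ : PS → PS → Set
f ≈ₚ g = ∀ n → f n ≡ g n

fromℕ : ℕ → ℚ
fromℕ n = (+ n) / 1

sumTo : ℕ → (ℕ → ℚ) → ℚ
sumTo zero f = f 0
sumTo (suc n) f = sumTo n f + f (suc n)

sumFrom : ℕ → ℕ → (ℕ → ℚ) → ℚ
sumFrom a b f = if a ≤ᵇ b then sumTo (b ℕ.∸ a) (λ i → f (a ℕ.+ i)) else 0ℚ

constₚ : ℚ → PS
constₚ c zero = c
constₚ c (suc n) = 0ℚ

zₚ : PS
zₚ 1 = 1ℚ
zₚ _ = 0ℚ

_+ₚ_ : PS → PS → PS
(f +ₚ g) n = f n + g n

_-ₚ_ : PS → PS → PS
(f -ₚ g) n = f n - g n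

_*ₚ_ : PS → PS → PS
(f *ₚ g) n = sumTo n (λ i → f i * g (n ℕ.∸ i))

infixl 6 _+ₚ_ _-ₚ_
infixl 7 _*ₚ_
infix 4 _≈ₚ_

_^ₚ_ : PS → ℕ → PS
f ^ₚ zero = constₚ 1ℚ
f ^ₚ suc r = f *ₚ (f ^ₚ r)

-- reciprocal of a rational (junk value 0 at 0)
recip : ℚ → ℚ
recip q with q ≟ 0ℚ
... | yes _ = 0ℚ
... | no q≢0 = 1/_ q {{≢-nonZero q≢0}}

-- multiplicative inverse of a power series with nonzero constant term:
-- g 0 = 1/f 0,  g n = -(1/f 0) Σ_{i=1}^{n} f i g (n-i).
-- invRev f n = [g n, g (n-1), …, g 0]
invRev : PS → ℕ → List ℚ
invRev f zero = recip (f 0) ∷ []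
invRev f (suc n) =
  (- (recip (f 0) * foldr _+_ 0ℚ
        (zipWith _*_ (map (λ i → f (suc i)) (upTo (suc n))) prev)))
  ∷ prev
  where prev = invRev f n

invₚ : PS → PS
invₚ f n with invRev f n
... | [] = 0ℚ
... | g ∷ _ = g

Pk : ℕ → PS
Pk k = constₚ 1ℚ -ₚ constₚ (fromℕ k) *ₚ zₚ -ₚ zₚ *ₚ zₚ

Δk : ℕ → PS
Δk k = Q *ₚ Q -ₚ constₚ (fromℕ 4) *ₚ zₚ *ₚ zₚ *ₚ Pk k *ₚ Pk k
  where Q = constₚ 1ℚ -ₚ constₚ (fromℕ (suc k)) *ₚ zₚ -ₚ zₚ *ₚ zₚ

-- convolved k-Fibonacci numbers:  (1-kx-x²)^{-r} = Σ_{j≥0} F^{(r)}_{k,j+1} x^j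
-- convF k r j = F^{(r)}_{k,j}  (meaningful for j ≥ 1)
convF : ℕ → ℕ → ℕ → ℚ
convF k r zero = 0ℚ  -- not used / undefined in the paper
convF k r (suc j) = (invₚ (Pk k) ^ₚ r) j

-- The continued fraction
-- a = 1 - z/(1-kz-z²);  K_0 = a, K_{j+1} = a - z²/K_j;
-- j-th truncation  CF_j = 1 / (a - 2z²/K_j).

aₖ : ℕ → PS
aₖ k = constₚ 1ℚ -ₚ zₚ *ₚ invₚ (Pk k)

Kₖ : ℕ → ℕ → PS
Kₖ k zero = aₖ k
Kₖ k (suc j) = aₖ k -ₚ zₚ *ₚ zₚ *ₚ invₚ (Kₖ k j)

cfTrunc : ℕ → ℕ → PS
cfTrunc k j = invₚ (aₖ k -ₚ constₚ (fromℕ 2) *ₚ zₚ *ₚ zₚ *ₚ invₚ (Kₖ k j))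

ConvergesTo : (ℕ → PS) → PS → Set
ConvergesTo c T = ∀ N → ∃[ J ] (∀ j → J ≤ j → ∀ n → n ≤ N → c j n ≡ T n)

coeffFormula : ℕ → ℕ → ℚ
coeffFormula k t =
  convF (suc k) 1 t +
  sumFrom 1 t (λ n → sumFrom 0 t (λ m →
    sumFrom0' t n m (λ l →
      fromℕ (2 ℕ.^ n) * term n m *
      fromℕ ((n ℕ.+ 2 ℕ.* m) C m) * fromℕ ((l ℕ.+ 2 ℕ.* n ℕ.+ 2 ℕ.* m) C l) *
      convF k l (suc (t ℕ.∸ (2 ℕ.* n ℕ.+ 2 ℕ.* m ℕ.+ l))))))
  where
  -- upper limit t-2n-2m as an honest (possibly negative) bound
  sumFrom0' : ℕ → ℕ → ℕ → (ℕ → ℚ) → ℚ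
  sumFrom0' t n m f = if (2 ℕ.* n ℕ.+ 2 ℕ.* m) ≤ᵇ t then sumTo (t ℕ.∸ (2 ℕ.* n ℕ.+ 2 ℕ.* m)) f else 0ℚ
  term : ℕ → ℕ → ℚ
  term zero m = 0ℚ
  term (suc n') m = (+ suc n') / (suc n' ℕ.+ 2 ℕ.* m)

-- Splitting a path at its first step shows that the numbers of paths of length n ending at height h
-- obey a recursion in n with a unique solution. Hence every family of series G 0, G 1, … with
--   G 0 = 1 + 2z·G 1 + F·G 0   and   G (j+1) = z·G j + z·G (j+2) + F·G (j+1),
-- where F = z/(1 − kz − z²) is the series of horizontal steps, counts the paths ending at height ±j;
-- in particular G 0 = T*. Two such families are used. With M = 1 + F·M + z²M², the family T·(zM)^j
-- with T = 1/(1 − F − 2z²M) gives the square root, √Δ = (1 − kz − z²)/T, and the continued fraction,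
-- because M = 1/(1 − F − z²M). With Y = 1/(1 − F) and u = zY, the family Y·Σ_N C(2N+j, N)·u^(2N+j)
-- gives the coefficients, via C(2N, N) = Σ_{n+m=N} 2^n·n/(n+2m)·C(n+2m, m),
-- Y^(K+1) = Σ_l C(K+l, l)·F^l and Y = 1 + z/(1 − (k+1)z − z²).

module Submission where

open import Defs
open import Data.Nat using (ℕ; _≤_)
open import Data.Fin using (Fin)
open import Data.Rational using (1ℚ)
open import Data.Product using (_×_; ∃-syntax)
open import Function.Bundles using (_↔_)
open import Relation.Binary.PropositionalEquality using (_≡_)

module FiniteSums where

  open import Defs using (sumTo)
  open import Data.Nat using (ℕ; zero; suc; _≤_; _<_; z≤n; s≤s; _∸_)
  import Data.Nat.Properties as ℕₚ
  open import Data.Rational using (ℚ; 0ℚ; _+_; _*_; -_)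
  open import Data.Rational.Properties
  open import Data.Maybe using (Maybe; just; nothing)
  open import Data.Sum using (inj₁; inj₂)
  open import Function using (_∘_)
  open import Relation.Nullary using (yes; no)
  open import Relation.Binary.PropositionalEquality
  open import Tactic.RingSolver.Core.AlmostCommutativeRing using (AlmostCommutativeRing; fromCommutativeRing)
  open import Tactic.RingSolver using (solve-∀)
  open ≡-Reasoning

  ℚ-ring : AlmostCommutativeRing _ _
  ℚ-ring = fromCommutativeRing +-*-commutativeRing is-zero?
    where
    is-zero? : ∀ x → _
    is-zero? x with 0ℚ ≟ x
    ... | yes 0≡x = just 0≡x
    ... | no _ = nothing

  sumTo-cong-≤ : ∀ n {f g : ℕ → ℚ} → (∀ i → i ≤ n → f i ≡ g i) → sumTo n f ≡ sumTo n g
  sumTo-cong-≤ zero e = e 0 z≤n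
  sumTo-cong-≤ (suc n) e = cong₂ _+_ (sumTo-cong-≤ n (λ i i≤n → e i (ℕₚ.m≤n⇒m≤1+n i≤n))) (e (suc n) ℕₚ.≤-refl)

  sumTo-cong : ∀ n {f g : ℕ → ℚ} → (∀ i → f i ≡ g i) → sumTo n f ≡ sumTo n g
  sumTo-cong n e = sumTo-cong-≤ n (λ i _ → e i)

  sumTo-zero : ∀ n (f : ℕ → ℚ) → (∀ i → i ≤ n → f i ≡ 0ℚ) → sumTo n f ≡ 0ℚ
  sumTo-zero n f e = trans (sumTo-cong-≤ n e) (all-zero n)
    where
    all-zero : ∀ n → sumTo n (λ _ → 0ℚ) ≡ 0ℚ
    all-zero zero = refl
    all-zero (suc n) = trans (+-identityʳ _) (all-zero n)

  sumTo-distrib-+ : ∀ n (f g : ℕ → ℚ) → sumTo n (λ i → f i + g i) ≡ sumTo n f + sumTo n g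
  sumTo-distrib-+ zero f g = refl
  sumTo-distrib-+ (suc n) f g = begin
    sumTo n (λ i → f i + g i) + (f (suc n) + g (suc n))
      ≡⟨ cong (_+ (f (suc n) + g (suc n))) (sumTo-distrib-+ n f g) ⟩
    (sumTo n f + sumTo n g) + (f (suc n) + g (suc n))
      ≡⟨ +-interchange (sumTo n f) (sumTo n g) (f (suc n)) (g (suc n)) ⟩
    (sumTo n f + f (suc n)) + (sumTo n g + g (suc n)) ∎
    where
    +-interchange : ∀ a b c d → (a + b) + (c + d) ≡ (a + c) + (b + d)
    +-interchange = solve-∀ ℚ-ring

  *-distribˡ-sumTo : ∀ n c (f : ℕ → ℚ) → c * sumTo n f ≡ sumTo n (λ i → c * f i)
  *-distribˡ-sumTo zero c f = refl
  *-distribˡ-sumTo (suc n) c f =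
    trans (*-distribˡ-+ c (sumTo n f) (f (suc n))) (cong (_+ c * f (suc n)) (*-distribˡ-sumTo n c f))

  *-distribʳ-sumTo : ∀ n c (f : ℕ → ℚ) → sumTo n f * c ≡ sumTo n (λ i → f i * c)
  *-distribʳ-sumTo n c f = begin
    sumTo n f * c ≡⟨ *-comm (sumTo n f) c ⟩
    c * sumTo n f ≡⟨ *-distribˡ-sumTo n c f ⟩
    sumTo n (λ i → c * f i) ≡⟨ sumTo-cong n (λ i → *-comm c (f i)) ⟩
    sumTo n (λ i → f i * c) ∎

  neg-distrib-sumTo : ∀ n (f : ℕ → ℚ) → - sumTo n f ≡ sumTo n (λ i → - f i)
  neg-distrib-sumTo zero f = refl
  neg-distrib-sumTo (suc n) f =
    trans (neg-distrib-+ (sumTo n f) (f (suc n))) (cong (_+ - f (suc n)) (neg-distrib-sumTo n f))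

  sumTo-head : ∀ n (f : ℕ → ℚ) → sumTo (suc n) f ≡ f 0 + sumTo n (f ∘ suc)
  sumTo-head zero f = refl
  sumTo-head (suc n) f = begin
    sumTo (suc n) f + f (suc (suc n))           ≡⟨ cong (_+ f (suc (suc n))) (sumTo-head n f) ⟩
    (f 0 + sumTo n (f ∘ suc)) + f (suc (suc n)) ≡⟨ +-assoc (f 0) _ _ ⟩
    f 0 + sumTo (suc n) (f ∘ suc)               ∎

  sumTo-reverse : ∀ n (f : ℕ → ℚ) → sumTo n f ≡ sumTo n (λ i → f (n ∸ i))
  sumTo-reverse zero f = refl
  sumTo-reverse (suc n) f = begin
    sumTo n f + f (suc n)                  ≡⟨ +-comm (sumTo n f) (f (suc n)) ⟩
    f (suc n) + sumTo n f                  ≡⟨ cong (f (suc n) +_) (sumTo-reverse n f) ⟩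
    f (suc n) + sumTo n (λ i → f (n ∸ i)) ≡⟨ sumTo-head n (λ i → f (suc n ∸ i)) ⟨
    sumTo (suc n) (λ i → f (suc n ∸ i))   ∎

  sumTo-comm : ∀ n m (f : ℕ → ℕ → ℚ) →
    sumTo n (λ i → sumTo m (f i)) ≡ sumTo m (λ j → sumTo n (λ i → f i j))
  sumTo-comm zero m f = refl
  sumTo-comm (suc n) m f = begin
    sumTo n (λ i → sumTo m (f i)) + sumTo m (f (suc n))
      ≡⟨ cong (_+ sumTo m (f (suc n))) (sumTo-comm n m f) ⟩
    sumTo m (λ j → sumTo n (λ i → f i j)) + sumTo m (f (suc n))
      ≡⟨ sumTo-distrib-+ m _ _ ⟨
    sumTo m (λ j → sumTo (suc n) (λ i → f i j)) ∎

  -- Re-indexing the triangle {(j, l) | j + l ≤ n} by rows instead of anti-diagonals.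
  sumTo-triangle : ∀ n (a : ℕ → ℕ → ℚ) →
    sumTo n (λ i → sumTo i (λ j → a j (i ∸ j))) ≡ sumTo n (λ j → sumTo (n ∸ j) (a j))
  sumTo-triangle zero a = refl
  sumTo-triangle (suc n) a = begin
    sumTo n (λ i → sumTo i (λ j → a j (i ∸ j))) + (rows + a (suc n) (n ∸ n))
      ≡⟨ cong (_+ (rows + a (suc n) (n ∸ n))) (sumTo-triangle n a) ⟩
    sumTo n (λ j → sumTo (n ∸ j) (a j)) + (rows + a (suc n) (n ∸ n))
      ≡⟨ +-assoc (sumTo n (λ j → sumTo (n ∸ j) (a j))) rows _ ⟨
    (sumTo n (λ j → sumTo (n ∸ j) (a j)) + rows) + a (suc n) (n ∸ n)
      ≡⟨ cong₂ _+_ (sym (sumTo-distrib-+ n _ _)) (cong (a (suc n)) (ℕₚ.n∸n≡0 n)) ⟩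
    sumTo n (λ j → sumTo (n ∸ j) (a j) + a j (suc n ∸ j)) + a (suc n) 0
      ≡⟨ cong (_+ a (suc n) 0) (sumTo-cong-≤ n extend-row) ⟩
    sumTo n (λ j → sumTo (suc n ∸ j) (a j)) + sumTo 0 (a (suc n))
      ≡⟨ cong (λ m → sumTo n (λ j → sumTo (suc n ∸ j) (a j)) + sumTo m (a (suc n))) (ℕₚ.n∸n≡0 n) ⟨
    sumTo (suc n) (λ j → sumTo (suc n ∸ j) (a j)) ∎
    where
    rows = sumTo n (λ j → a j (suc n ∸ j))
    extend-row : ∀ j → j ≤ n → sumTo (n ∸ j) (a j) + a j (suc n ∸ j) ≡ sumTo (suc n ∸ j) (a j)
    extend-row j j≤n rewrite ℕₚ.+-∸-assoc 1 j≤n = refl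

  sumTo-extend : ∀ a b (f : ℕ → ℚ) → a ≤ b → (∀ i → a < i → i ≤ b → f i ≡ 0ℚ) → sumTo a f ≡ sumTo b f
  sumTo-extend a zero f z≤n _ = refl
  sumTo-extend a (suc b) f a≤1+b e with ℕₚ.m≤n⇒m<n∨m≡n a≤1+b
  ... | inj₂ refl = refl
  ... | inj₁ (s≤s a≤b) = begin
    sumTo a f                 ≡⟨ sumTo-extend a b f a≤b (λ i a<i i≤b → e i a<i (ℕₚ.m≤n⇒m≤1+n i≤b)) ⟩
    sumTo b f                 ≡⟨ +-identityʳ (sumTo b f) ⟨
    sumTo b f + 0ℚ            ≡⟨ cong (sumTo b f +_) (e (suc b) (s≤s a≤b) ℕₚ.≤-refl) ⟨
    sumTo b f + f (suc b)     ∎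


module NatCast where

  open import Defs using (fromℕ)
  open import Data.Nat as ℕ using (zero; suc)
  open import Data.Integer as ℤ using ()
  open import Data.Rational using (0ℚ; 1ℚ; _+_; _*_; _/_; toℚᵘ; 1/_; ≢-nonZero)
  open import Data.Rational.Properties
  import Data.Rational.Unnormalised as ℚᵘ
  import Data.Rational.Unnormalised.Properties as ℚᵘₚ
  open import Data.Integer.Tactic.RingSolver using (solve-∀)
  open import Relation.Nullary using (¬_)
  open import Relation.Binary.PropositionalEquality

  toℚᵘ-fromℕ : ∀ n → toℚᵘ (fromℕ n) ℚᵘ.≃ ℚᵘ.mkℚᵘ (ℤ.+ n) 0
  toℚᵘ-fromℕ n = toℚᵘ-fromℚᵘ (ℚᵘ.mkℚᵘ (ℤ.+ n) 0)

  fromℕ-suc : ∀ n → fromℕ (suc n) ≡ 1ℚ + fromℕ n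
  fromℕ-suc n = toℚᵘ-injective (begin
    toℚᵘ (fromℕ (suc n))                                 ≈⟨ toℚᵘ-fromℕ (suc n) ⟩
    ℚᵘ.mkℚᵘ (ℤ.+ suc n) 0                                ≈⟨ ℚᵘ.*≡* (cross-multiplied (ℤ.+ n)) ⟩
    ℚᵘ.mkℚᵘ (ℤ.+ 1) 0 ℚᵘ.+ ℚᵘ.mkℚᵘ (ℤ.+ n) 0            ≈⟨ ℚᵘₚ.+-cong (toℚᵘ-fromℕ 1) (toℚᵘ-fromℕ n) ⟨
    toℚᵘ (fromℕ 1) ℚᵘ.+ toℚᵘ (fromℕ n)                   ≈⟨ toℚᵘ-homo-+ 1ℚ (fromℕ n) ⟨
    toℚᵘ (1ℚ + fromℕ n)                                  ∎)
    where
    open ℚᵘₚ.≃-Reasoning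
    cross-multiplied : ∀ x → (ℤ.+ 1 ℤ.+ x) ℤ.* (ℤ.+ 1 ℤ.* ℤ.+ 1) ≡ (ℤ.+ 1 ℤ.* ℤ.+ 1 ℤ.+ x ℤ.* ℤ.+ 1) ℤ.* ℤ.+ 1
    cross-multiplied = solve-∀

  fromℕ-+ : ∀ m n → fromℕ (m ℕ.+ n) ≡ fromℕ m + fromℕ n
  fromℕ-+ zero n = sym (+-identityˡ (fromℕ n))
  fromℕ-+ (suc m) n = begin
    fromℕ (suc (m ℕ.+ n))      ≡⟨ fromℕ-suc (m ℕ.+ n) ⟩
    1ℚ + fromℕ (m ℕ.+ n)       ≡⟨ cong (1ℚ +_) (fromℕ-+ m n) ⟩
    1ℚ + (fromℕ m + fromℕ n)   ≡⟨ +-assoc 1ℚ (fromℕ m) (fromℕ n) ⟨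
    (1ℚ + fromℕ m) + fromℕ n   ≡⟨ cong (_+ fromℕ n) (fromℕ-suc m) ⟨
    fromℕ (suc m) + fromℕ n    ∎
    where open ≡-Reasoning

  fromℕ-* : ∀ m n → fromℕ (m ℕ.* n) ≡ fromℕ m * fromℕ n
  fromℕ-* zero n = sym (*-zeroˡ (fromℕ n))
  fromℕ-* (suc m) n = begin
    fromℕ (n ℕ.+ m ℕ.* n)               ≡⟨ fromℕ-+ n (m ℕ.* n) ⟩
    fromℕ n + fromℕ (m ℕ.* n)           ≡⟨ cong₂ _+_ (sym (*-identityˡ (fromℕ n))) (fromℕ-* m n) ⟩
    1ℚ * fromℕ n + fromℕ m * fromℕ n    ≡⟨ *-distribʳ-+ (fromℕ n) 1ℚ (fromℕ m) ⟨
    (1ℚ + fromℕ m) * fromℕ n            ≡⟨ cong (_* fromℕ n) (fromℕ-suc m) ⟨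
    fromℕ (suc m) * fromℕ n             ∎
    where open ≡-Reasoning

  fromℕ-suc≢0 : ∀ n → ¬ (fromℕ (suc n) ≡ 0ℚ)
  fromℕ-suc≢0 n eq with ℚᵘₚ.≃-trans (ℚᵘₚ.≃-sym (toℚᵘ-fromℕ (suc n))) (ℚᵘₚ.≃-reflexive (cong toℚᵘ eq))
  ... | ℚᵘ.*≡* ()

  /-*-fromℕ : ∀ a d → ((ℤ.+ a) / suc d) * fromℕ (suc d) ≡ fromℕ a
  /-*-fromℕ a d = toℚᵘ-injective (begin
    toℚᵘ ((ℤ.+ a) / suc d * fromℕ (suc d))
      ≈⟨ toℚᵘ-homo-* ((ℤ.+ a) / suc d) (fromℕ (suc d)) ⟩
    toℚᵘ ((ℤ.+ a) / suc d) ℚᵘ.* toℚᵘ (fromℕ (suc d))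
      ≈⟨ ℚᵘₚ.*-cong (toℚᵘ-fromℚᵘ (ℚᵘ.mkℚᵘ (ℤ.+ a) d)) (toℚᵘ-fromℕ (suc d)) ⟩
    ℚᵘ.mkℚᵘ (ℤ.+ a) d ℚᵘ.* ℚᵘ.mkℚᵘ (ℤ.+ suc d) 0
      ≈⟨ ℚᵘ.*≡* (cross-multiplied (ℤ.+ a) (ℤ.+ suc d)) ⟩
    ℚᵘ.mkℚᵘ (ℤ.+ a) 0
      ≈⟨ toℚᵘ-fromℕ a ⟨
    toℚᵘ (fromℕ a) ∎)
    where
    open ℚᵘₚ.≃-Reasoning
    cross-multiplied : ∀ x y → (x ℤ.* y) ℤ.* ℤ.+ 1 ≡ x ℤ.* (y ℤ.* ℤ.+ 1)
    cross-multiplied = solve-∀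

  *-cancelʳ-≢0 : ∀ x y c → ¬ (c ≡ 0ℚ) → x * c ≡ y * c → x ≡ y
  *-cancelʳ-≢0 x y c c≢0 eq = begin
    x                ≡⟨ *-identityʳ x ⟨
    x * 1ℚ           ≡⟨ cong (x *_) (*-inverseʳ c) ⟨
    x * (c * c⁻¹)    ≡⟨ *-assoc x c c⁻¹ ⟨
    (x * c) * c⁻¹    ≡⟨ cong (_* c⁻¹) eq ⟩
    (y * c) * c⁻¹    ≡⟨ *-assoc y c c⁻¹ ⟩
    y * (c * c⁻¹)    ≡⟨ cong (y *_) (*-inverseʳ c) ⟩
    y * 1ℚ           ≡⟨ *-identityʳ y ⟩
    y                ∎
    where
    open ≡-Reasoning
    instance _ = ≢-nonZero c≢0
    c⁻¹ = 1/ c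


module PowerSeries where

  open import Defs
  open FiniteSums
  open import Data.Nat as ℕ using (zero; suc; _≤_; _<_; s≤s; _∸_)
  import Data.Nat.Properties as ℕₚ
  open import Data.Rational using (0ℚ; 1ℚ; _+_; _*_; _-_; -_; +-*-rawRing)
  open import Data.Rational.Properties
  open import Data.Product using (_,_)
  open import Data.Maybe using (Maybe)
  import Data.Maybe
  open import Relation.Nullary.Decidable using (dec⇒maybe)
  open import Algebra.Bundles using (CommutativeRing)
  open import Algebra.Structures using (IsCommutativeRing)
  open import Algebra.Solver.Ring.AlmostCommutativeRing as ACR using (_-Raw-AlmostCommutative⟶_)
  import Algebra.Solver.Ring
  open import Relation.Binary.Bundles using (Setoid)
  import Relation.Binary.Reasoning.Setoid as SetoidReasoning
  open import Relation.Binary.PropositionalEquality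

  negₚ : PS → PS
  negₚ f n = - f n

  0ₚ : PS
  0ₚ _ = 0ℚ

  1ₚ : PS
  1ₚ = constₚ 1ℚ

  ≈ₚ-refl : ∀ {f} → f ≈ₚ f
  ≈ₚ-refl n = refl

  ≈ₚ-sym : ∀ {f g} → f ≈ₚ g → g ≈ₚ f
  ≈ₚ-sym e n = sym (e n)

  ≈ₚ-trans : ∀ {f g h} → f ≈ₚ g → g ≈ₚ h → f ≈ₚ h
  ≈ₚ-trans e e′ n = trans (e n) (e′ n)

  ps-setoid : Setoid _ _
  ps-setoid = record
    { Carrier = PS ; _≈_ = _≈ₚ_
    ; isEquivalence = record { refl = ≈ₚ-refl ; sym = ≈ₚ-sym ; trans = ≈ₚ-trans } }

  module ≈ₚ-Reasoning = SetoidReasoning ps-setoid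

  +ₚ-cong : ∀ {f f′ g g′} → f ≈ₚ f′ → g ≈ₚ g′ → f +ₚ g ≈ₚ f′ +ₚ g′
  +ₚ-cong e e′ n = cong₂ _+_ (e n) (e′ n)

  *ₚ-cong : ∀ {f f′ g g′} → f ≈ₚ f′ → g ≈ₚ g′ → f *ₚ g ≈ₚ f′ *ₚ g′
  *ₚ-cong e e′ n = sumTo-cong n (λ i → cong₂ _*_ (e i) (e′ (n ∸ i)))

  *ₚ-congˡ : ∀ f {g g′} → g ≈ₚ g′ → f *ₚ g ≈ₚ f *ₚ g′
  *ₚ-congˡ f = *ₚ-cong {f} {f} ≈ₚ-refl

  *ₚ-congʳ : ∀ g {f f′} → f ≈ₚ f′ → f *ₚ g ≈ₚ f′ *ₚ g
  *ₚ-congʳ g e = *ₚ-cong e (≈ₚ-refl {g})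

  *ₚ-comm : ∀ f g → f *ₚ g ≈ₚ g *ₚ f
  *ₚ-comm f g n = begin
    sumTo n (λ i → f i * g (n ∸ i))             ≡⟨ sumTo-reverse n _ ⟩
    sumTo n (λ i → f (n ∸ i) * g (n ∸ (n ∸ i))) ≡⟨ sumTo-cong-≤ n swap ⟩
    sumTo n (λ i → g i * f (n ∸ i))             ∎
    where
    open ≡-Reasoning
    swap : ∀ i → i ≤ n → f (n ∸ i) * g (n ∸ (n ∸ i)) ≡ g i * f (n ∸ i)
    swap i i≤n rewrite ℕₚ.m∸[m∸n]≡n i≤n = *-comm (f (n ∸ i)) (g i)

  *ₚ-assoc : ∀ f g h → (f *ₚ g) *ₚ h ≈ₚ f *ₚ (g *ₚ h)
  *ₚ-assoc f g h n = begin
    sumTo n (λ i → sumTo i (λ j → f j * g (i ∸ j)) * h (n ∸ i))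
      ≡⟨ sumTo-cong n (λ i → *-distribʳ-sumTo i _ _) ⟩
    sumTo n (λ i → sumTo i (λ j → f j * g (i ∸ j) * h (n ∸ i)))
      ≡⟨ sumTo-cong-≤ n (λ i _ → sumTo-cong-≤ i (λ j j≤i → cong (λ m → f j * g (i ∸ j) * h (n ∸ m)) (sym (ℕₚ.m+[n∸m]≡n j≤i)))) ⟩
    sumTo n (λ i → sumTo i (λ j → f j * g (i ∸ j) * h (n ∸ (j ℕ.+ (i ∸ j)))))
      ≡⟨ sumTo-triangle n (λ j l → f j * g l * h (n ∸ (j ℕ.+ l))) ⟩
    sumTo n (λ j → sumTo (n ∸ j) (λ l → f j * g l * h (n ∸ (j ℕ.+ l))))
      ≡⟨ sumTo-cong n (λ j → sumTo-cong (n ∸ j) (λ l → reassoc j l)) ⟩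
    sumTo n (λ j → sumTo (n ∸ j) (λ l → f j * (g l * h ((n ∸ j) ∸ l))))
      ≡⟨ sumTo-cong n (λ j → *-distribˡ-sumTo (n ∸ j) (f j) _) ⟨
    sumTo n (λ j → f j * sumTo (n ∸ j) (λ l → g l * h ((n ∸ j) ∸ l))) ∎
    where
    open ≡-Reasoning
    reassoc : ∀ j l → f j * g l * h (n ∸ (j ℕ.+ l)) ≡ f j * (g l * h ((n ∸ j) ∸ l))
    reassoc j l rewrite ℕₚ.∸-+-assoc n j l = *-assoc (f j) (g l) _

  *ₚ-distribˡ-+ₚ : ∀ f g h → f *ₚ (g +ₚ h) ≈ₚ f *ₚ g +ₚ f *ₚ h
  *ₚ-distribˡ-+ₚ f g h n =
    trans (sumTo-cong n (λ i → *-distribˡ-+ (f i) (g (n ∸ i)) (h (n ∸ i)))) (sumTo-distrib-+ n _ _)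

  *ₚ-distribʳ-+ₚ : ∀ f g h → (g +ₚ h) *ₚ f ≈ₚ g *ₚ f +ₚ h *ₚ f
  *ₚ-distribʳ-+ₚ f g h n =
    trans (sumTo-cong n (λ i → *-distribʳ-+ (f (n ∸ i)) (g i) (h i))) (sumTo-distrib-+ n _ _)

  constₚ-*ₚ : ∀ c f → constₚ c *ₚ f ≈ₚ (λ n → c * f n)
  constₚ-*ₚ c f zero = refl
  constₚ-*ₚ c f (suc n) = begin
    sumTo (suc n) (λ i → constₚ c i * f (suc n ∸ i))   ≡⟨ sumTo-head n _ ⟩
    c * f (suc n) + sumTo n (λ i → 0ℚ * f (n ∸ i))    ≡⟨ cong (c * f (suc n) +_) (sumTo-zero n _ (λ i _ → *-zeroˡ (f (n ∸ i)))) ⟩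
    c * f (suc n) + 0ℚ                                 ≡⟨ +-identityʳ (c * f (suc n)) ⟩
    c * f (suc n)                                      ∎
    where open ≡-Reasoning

  *ₚ-identityˡ : ∀ f → 1ₚ *ₚ f ≈ₚ f
  *ₚ-identityˡ f n = trans (constₚ-*ₚ 1ℚ f n) (*-identityˡ (f n))

  *ₚ-identityʳ : ∀ f → f *ₚ 1ₚ ≈ₚ f
  *ₚ-identityʳ f n = trans (*ₚ-comm f 1ₚ n) (*ₚ-identityˡ f n)

  ps-isCommutativeRing : IsCommutativeRing _≈ₚ_ _+ₚ_ _*ₚ_ negₚ 0ₚ 1ₚ
  ps-isCommutativeRing = record
    { isRing = record
      { +-isAbelianGroup = record
        { isGroup = record
          { isMonoid = record
            { isSemigroup = record
              { isMagma = record
                { isEquivalence = Setoid.isEquivalence ps-setoid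
                ; ∙-cong = +ₚ-cong }
              ; assoc = λ f g h n → +-assoc (f n) (g n) (h n) }
            ; identity = (λ f n → +-identityˡ (f n)) , (λ f n → +-identityʳ (f n)) }
          ; inverse = (λ f n → +-inverseˡ (f n)) , (λ f n → +-inverseʳ (f n))
          ; ⁻¹-cong = λ e n → cong -_ (e n) }
        ; comm = λ f g n → +-comm (f n) (g n) }
      ; *-cong = *ₚ-cong
      ; *-assoc = *ₚ-assoc
      ; *-identity = *ₚ-identityˡ , *ₚ-identityʳ
      ; distrib = *ₚ-distribˡ-+ₚ , *ₚ-distribʳ-+ₚ }
    ; *-comm = *ₚ-comm }

  ps-commutativeRing : CommutativeRing _ _
  ps-commutativeRing = record { isCommutativeRing = ps-isCommutativeRing }

  constₚ-homomorphism : +-*-rawRing -Raw-AlmostCommutative⟶ ACR.fromCommutativeRing ps-commutativeRing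
  constₚ-homomorphism = record
    { ⟦_⟧ = constₚ
    ; +-homo = λ { a b zero → refl ; a b (suc n) → sym (+-identityˡ 0ℚ) }
    ; *-homo = λ a b n → sym (trans (constₚ-*ₚ a (constₚ b) n) (scale {a} {b} n))
    ; -‿homo = λ { a zero → refl ; a (suc n) → refl }
    ; 0-homo = λ { zero → refl ; (suc n) → refl }
    ; 1-homo = λ { zero → refl ; (suc n) → refl } }
    where
    scale : ∀ {a b} n → a * constₚ b n ≡ constₚ (a * b) n
    scale zero = refl
    scale {a} (suc n) = *-zeroʳ a

  constₚ-≟ : ∀ a b → Maybe (constₚ a ≈ₚ constₚ b)
  constₚ-≟ a b = Data.Maybe.map (λ { refl _ → refl }) (dec⇒maybe (a ≟ b))

  module PS-Solver = Algebra.Solver.Ring +-*-rawRing (ACR.fromCommutativeRing ps-commutativeRing) constₚ-homomorphism constₚ-≟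

  zₚ-*ₚ-zero : ∀ f → (zₚ *ₚ f) 0 ≡ 0ℚ
  zₚ-*ₚ-zero f = *-zeroˡ (f 0)

  zₚ-*ₚ-suc : ∀ f n → (zₚ *ₚ f) (suc n) ≡ f n
  zₚ-*ₚ-suc f n = begin
    sumTo (suc n) (λ i → zₚ i * f (suc n ∸ i))          ≡⟨ sumTo-head n _ ⟩
    0ℚ * f (suc n) + sumTo n (λ i → zₚ (suc i) * f (n ∸ i)) ≡⟨ cong₂ _+_ (*-zeroˡ (f (suc n))) (picks-head n) ⟩
    0ℚ + f n                                             ≡⟨ +-identityˡ (f n) ⟩
    f n                                                  ∎
    where
    open ≡-Reasoning
    picks-head : ∀ m → sumTo m (λ i → zₚ (suc i) * f (m ∸ i)) ≡ f m
    picks-head zero = *-identityˡ (f 0)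
    picks-head (suc m) = begin
      sumTo (suc m) (λ i → zₚ (suc i) * f (suc m ∸ i))       ≡⟨ sumTo-head m _ ⟩
      1ℚ * f (suc m) + sumTo m (λ i → 0ℚ * f (m ∸ i))      ≡⟨ cong₂ _+_ (*-identityˡ (f (suc m))) (sumTo-zero m _ (λ i _ → *-zeroˡ (f (m ∸ i)))) ⟩
      f (suc m) + 0ℚ                                       ≡⟨ +-identityʳ (f (suc m)) ⟩
      f (suc m)                                            ∎

  z²-*ₚ-zero : ∀ f → (zₚ *ₚ zₚ *ₚ f) 0 ≡ 0ℚ
  z²-*ₚ-zero f = trans (*ₚ-assoc zₚ zₚ f 0) (zₚ-*ₚ-zero (zₚ *ₚ f))

  z²-*ₚ-one : ∀ f → (zₚ *ₚ zₚ *ₚ f) 1 ≡ 0ℚ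
  z²-*ₚ-one f = trans (*ₚ-assoc zₚ zₚ f 1) (trans (zₚ-*ₚ-suc (zₚ *ₚ f) 0) (zₚ-*ₚ-zero f))

  z²-*ₚ-suc-suc : ∀ f n → (zₚ *ₚ zₚ *ₚ f) (suc (suc n)) ≡ f n
  z²-*ₚ-suc-suc f n = trans (*ₚ-assoc zₚ zₚ f (suc (suc n))) (trans (zₚ-*ₚ-suc (zₚ *ₚ f) (suc n)) (zₚ-*ₚ-suc f n))

  zₚ^-*ₚ-≥ : ∀ m f t → m ≤ t → (zₚ ^ₚ m *ₚ f) t ≡ f (t ∸ m)
  zₚ^-*ₚ-≥ zero f t _ = *ₚ-identityˡ f t
  zₚ^-*ₚ-≥ (suc m) f (suc t) (s≤s m≤t) =
    trans (*ₚ-assoc zₚ (zₚ ^ₚ m) f (suc t)) (trans (zₚ-*ₚ-suc (zₚ ^ₚ m *ₚ f) t) (zₚ^-*ₚ-≥ m f t m≤t))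

  zₚ^-*ₚ-< : ∀ m f t → t < m → (zₚ ^ₚ m *ₚ f) t ≡ 0ℚ
  zₚ^-*ₚ-< (suc m) f zero _ = trans (*ₚ-assoc zₚ (zₚ ^ₚ m) f 0) (zₚ-*ₚ-zero (zₚ ^ₚ m *ₚ f))
  zₚ^-*ₚ-< (suc m) f (suc t) (s≤s t<m) =
    trans (*ₚ-assoc zₚ (zₚ ^ₚ m) f (suc t)) (trans (zₚ-*ₚ-suc (zₚ ^ₚ m *ₚ f) t) (zₚ^-*ₚ-< m f t t<m))

  open PS-Solver using (solve; _:*_; _:=_)

  ^ₚ-cong : ∀ {f f′} → f ≈ₚ f′ → ∀ m → f ^ₚ m ≈ₚ f′ ^ₚ m
  ^ₚ-cong e zero = ≈ₚ-refl
  ^ₚ-cong e (suc m) = *ₚ-cong e (^ₚ-cong e m)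

  ^ₚ-distrib-*ₚ : ∀ f g m → (f *ₚ g) ^ₚ m ≈ₚ f ^ₚ m *ₚ g ^ₚ m
  ^ₚ-distrib-*ₚ f g zero = ≈ₚ-sym (*ₚ-identityˡ 1ₚ)
  ^ₚ-distrib-*ₚ f g (suc m) = begin
    (f *ₚ g) *ₚ (f *ₚ g) ^ₚ m     ≈⟨ *ₚ-congˡ (f *ₚ g) (^ₚ-distrib-*ₚ f g m) ⟩
    (f *ₚ g) *ₚ (f ^ₚ m *ₚ g ^ₚ m) ≈⟨ solve 4 (λ x y a b → (x :* y) :* (a :* b) := (x :* a) :* (y :* b)) (λ _ → refl) f g (f ^ₚ m) (g ^ₚ m) ⟩
    f ^ₚ suc m *ₚ g ^ₚ suc m      ∎
    where open ≈ₚ-Reasoning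

  ^ₚ-head : ∀ f → f 0 ≡ 1ℚ → ∀ m → (f ^ₚ m) 0 ≡ 1ℚ
  ^ₚ-head f e zero = refl
  ^ₚ-head f e (suc m) = trans (cong₂ _*_ e (^ₚ-head f e m)) (*-identityˡ 1ℚ)

  ≈0ₚ-*ₚ : ∀ {r} → r ≈ₚ 0ₚ → ∀ g → r *ₚ g ≈ₚ 0ₚ
  ≈0ₚ-*ₚ r≈0 g n = sumTo-zero n _ (λ i _ → trans (cong (_* g (n ∸ i)) (r≈0 i)) (*-zeroˡ (g (n ∸ i))))

  -ₚ-≈0ₚ : ∀ {f g} → f ≈ₚ g → f -ₚ g ≈ₚ 0ₚ
  -ₚ-≈0ₚ {g = g} f≈g n = trans (cong (_- g n) (f≈g n)) (+-inverseʳ (g n))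

  ≈ₚ-modulo : ∀ {f g r} → f ≈ₚ g +ₚ r → r ≈ₚ 0ₚ → f ≈ₚ g
  ≈ₚ-modulo {g = g} f≈g+r r≈0 n = trans (f≈g+r n) (trans (cong (g n +_) (r≈0 n)) (+-identityʳ (g n)))

  *ₚ-≈0ₚ : ∀ f {r} → r ≈ₚ 0ₚ → f *ₚ r ≈ₚ 0ₚ
  *ₚ-≈0ₚ f {r} r≈0 n = trans (*ₚ-comm f r n) (≈0ₚ-*ₚ r≈0 f n)

  1ₚ-^ₚ : ∀ m → 1ₚ ^ₚ m ≈ₚ 1ₚ
  1ₚ-^ₚ zero = ≈ₚ-refl
  1ₚ-^ₚ (suc m) = ≈ₚ-trans (*ₚ-identityˡ (1ₚ ^ₚ m)) (1ₚ-^ₚ m)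

  ^ₚ-inverse : ∀ f g → f *ₚ g ≈ₚ 1ₚ → ∀ m → f ^ₚ m *ₚ g ^ₚ m ≈ₚ 1ₚ
  ^ₚ-inverse f g fg≈1 m = begin
    f ^ₚ m *ₚ g ^ₚ m   ≈⟨ ^ₚ-distrib-*ₚ f g m ⟨
    (f *ₚ g) ^ₚ m      ≈⟨ ^ₚ-cong fg≈1 m ⟩
    1ₚ ^ₚ m            ≈⟨ 1ₚ-^ₚ m ⟩
    1ₚ                 ∎
    where open ≈ₚ-Reasoning


module Reciprocal where

  open import Defs
  open FiniteSums
  open PowerSeries
  open import Data.Nat using (ℕ; zero; suc; _≤_; _<_; z≤n; s≤s; _∸_)
  import Data.Nat.Properties as ℕₚ
  open import Data.Rational using (ℚ; 0ℚ; 1ℚ; _+_; _*_; _-_; -_; ≢-nonZero)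
  open import Data.Rational.Properties
  open import Data.List using (map; zipWith; foldr; applyUpTo)
  open import Data.Sum using (inj₁; inj₂)
  open import Function using (_∘_; id)
  open import Relation.Nullary using (yes; no; ¬_; contradiction)
  open import Relation.Binary.PropositionalEquality
  open import Tactic.RingSolver using (solve-∀)

  infix 4 _≈[_]_
  _≈[_]_ : PS → ℕ → PS → Set
  f ≈[ N ] g = ∀ i → i ≤ N → f i ≡ g i

  ≈[]-trans : ∀ {N f g h} → f ≈[ N ] g → g ≈[ N ] h → f ≈[ N ] h
  ≈[]-trans e e′ i i≤N = trans (e i i≤N) (e′ i i≤N)

  ≈[]-weaken : ∀ {N f g} → f ≈[ suc N ] g → f ≈[ N ] g
  ≈[]-weaken e i i≤N = e i (ℕₚ.m≤n⇒m≤1+n i≤N)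

  *ₚ-cong-≈[] : ∀ N {f f′ g g′} → f ≈[ N ] f′ → g ≈[ N ] g′ → f *ₚ g ≈[ N ] f′ *ₚ g′
  *ₚ-cong-≈[] N e e′ i i≤N = sumTo-cong-≤ i (λ j j≤i →
    cong₂ _*_ (e j (ℕₚ.≤-trans j≤i i≤N)) (e′ (i ∸ j) (ℕₚ.≤-trans (ℕₚ.m∸n≤m i j) i≤N)))

  -ₚ-cong-≈[] : ∀ N {f f′ g g′} → f ≈[ N ] f′ → g ≈[ N ] g′ → f -ₚ g ≈[ N ] f′ -ₚ g′
  -ₚ-cong-≈[] N e e′ i i≤N = cong₂ _-_ (e i i≤N) (e′ i i≤N)

  z²-*ₚ-cong-≈[] : ∀ N {f g} → f ≈[ N ] g → zₚ *ₚ zₚ *ₚ f ≈[ suc (suc N) ] zₚ *ₚ zₚ *ₚ g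
  z²-*ₚ-cong-≈[] N {f} {g} e zero _ = trans (z²-*ₚ-zero f) (sym (z²-*ₚ-zero g))
  z²-*ₚ-cong-≈[] N {f} {g} e (suc zero) _ = trans (z²-*ₚ-one f) (sym (z²-*ₚ-one g))
  z²-*ₚ-cong-≈[] N {f} {g} e (suc (suc i)) (s≤s (s≤s i≤N)) =
    trans (z²-*ₚ-suc-suc f i) (trans (e i i≤N) (sym (z²-*ₚ-suc-suc g i)))

  *ₚ-cong-below : ∀ f n {g g′} → f 0 ≡ 0ℚ → (∀ m → m < n → g m ≡ g′ m) → (f *ₚ g) n ≡ (f *ₚ g′) n
  *ₚ-cong-below f zero {g} {g′} f₀≡0 _ = begin
    f 0 * g 0   ≡⟨ cong (_* g 0) f₀≡0 ⟩
    0ℚ * g 0    ≡⟨ *-zeroˡ (g 0) ⟩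
    0ℚ          ≡⟨ *-zeroˡ (g′ 0) ⟨
    0ℚ * g′ 0   ≡⟨ cong (_* g′ 0) f₀≡0 ⟨
    f 0 * g′ 0  ∎
    where open ≡-Reasoning
  *ₚ-cong-below f (suc n) {g} {g′} f₀≡0 e = begin
    sumTo (suc n) (λ i → f i * g (suc n ∸ i))               ≡⟨ sumTo-head n _ ⟩
    f 0 * g (suc n) + sumTo n (λ i → f (suc i) * g (n ∸ i))  ≡⟨ cong₂ _+_ head-vanishes tail-agrees ⟩
    f 0 * g′ (suc n) + sumTo n (λ i → f (suc i) * g′ (n ∸ i)) ≡⟨ sumTo-head n _ ⟨
    sumTo (suc n) (λ i → f i * g′ (suc n ∸ i))              ∎
    where
    open ≡-Reasoning
    head-vanishes : f 0 * g (suc n) ≡ f 0 * g′ (suc n)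
    head-vanishes rewrite f₀≡0 = trans (*-zeroˡ (g (suc n))) (sym (*-zeroˡ (g′ (suc n))))
    tail-agrees : sumTo n (λ i → f (suc i) * g (n ∸ i)) ≡ sumTo n (λ i → f (suc i) * g′ (n ∸ i))
    tail-agrees = sumTo-cong n (λ i → cong (f (suc i) *_) (e (n ∸ i) (s≤s (ℕₚ.m∸n≤m n i))))

  recip-inverseʳ : ∀ q → ¬ (q ≡ 0ℚ) → q * recip q ≡ 1ℚ
  recip-inverseʳ q q≢0 with q ≟ 0ℚ
  ... | yes q≡0 = contradiction q≡0 q≢0
  ... | no q≢0′ = *-inverseʳ q {{≢-nonZero q≢0′}}

  module _ (f : PS) where

    private
      foldr-invRev : ∀ n (u : ℕ → ℕ) (h : ℕ → ℚ) →
        foldr _+_ 0ℚ (zipWith _*_ (map h (applyUpTo u (suc n))) (invRev f n)) ≡ sumTo n (λ i → h (u i) * invₚ f (n ∸ i))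
      foldr-invRev zero u h = +-identityʳ (h (u 0) * recip (f 0))
      foldr-invRev (suc n) u h = begin
        h (u 0) * invₚ f (suc n) + foldr _+_ 0ℚ (zipWith _*_ (map h (applyUpTo (u ∘ suc) (suc n))) (invRev f n))
          ≡⟨ cong (h (u 0) * invₚ f (suc n) +_) (foldr-invRev n (u ∘ suc) h) ⟩
        h (u 0) * invₚ f (suc n) + sumTo n (λ i → h (u (suc i)) * invₚ f (n ∸ i))
          ≡⟨ sumTo-head n (λ i → h (u i) * invₚ f (suc n ∸ i)) ⟨
        sumTo (suc n) (λ i → h (u i) * invₚ f (suc n ∸ i)) ∎
        where open ≡-Reasoning

    invₚ-suc : ∀ n → invₚ f (suc n) ≡ - (recip (f 0) * sumTo n (λ i → f (suc i) * invₚ f (n ∸ i)))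
    invₚ-suc n = cong (λ x → - (recip (f 0) * x)) (foldr-invRev n id (f ∘ suc))

    invₚ-inverseʳ : ¬ (f 0 ≡ 0ℚ) → f *ₚ invₚ f ≈ₚ 1ₚ
    invₚ-inverseʳ f₀≢0 zero = recip-inverseʳ (f 0) f₀≢0
    invₚ-inverseʳ f₀≢0 (suc n) = begin
      sumTo (suc n) (λ i → f i * invₚ f (suc n ∸ i)) ≡⟨ sumTo-head n _ ⟩
      f 0 * invₚ f (suc n) + rest                    ≡⟨ cong (λ y → f 0 * y + rest) (invₚ-suc n) ⟩
      f 0 * - (recip (f 0) * rest) + rest            ≡⟨ cancel (f 0) (recip (f 0)) rest ⟩
      (1ℚ - f 0 * recip (f 0)) * rest                ≡⟨ cong (λ y → (1ℚ - y) * rest) (recip-inverseʳ (f 0) f₀≢0) ⟩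
      (1ℚ - 1ℚ) * rest                               ≡⟨ *-zeroˡ rest ⟩
      0ℚ                                             ∎
      where
      open ≡-Reasoning
      rest = sumTo n (λ i → f (suc i) * invₚ f (n ∸ i))
      cancel : ∀ a r x → a * - (r * x) + x ≡ (1ℚ - a * r) * x
      cancel = solve-∀ ℚ-ring

    invₚ-unique : ∀ g → ¬ (f 0 ≡ 0ℚ) → f *ₚ g ≈ₚ 1ₚ → g ≈ₚ invₚ f
    invₚ-unique g f₀≢0 fg≈1 = begin
      g                      ≈⟨ *ₚ-identityˡ g ⟨
      1ₚ *ₚ g                ≈⟨ *ₚ-congʳ g (invₚ-inverseʳ f₀≢0) ⟨
      (f *ₚ invₚ f) *ₚ g     ≈⟨ PS-Solver.solve 3 (λ a b c → (a :* b) :* c := (a :* c) :* b) (λ _ → refl) f (invₚ f) g ⟩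
      (f *ₚ g) *ₚ invₚ f     ≈⟨ *ₚ-congʳ (invₚ f) fg≈1 ⟩
      1ₚ *ₚ invₚ f           ≈⟨ *ₚ-identityˡ (invₚ f) ⟩
      invₚ f                 ∎
      where
      open ≈ₚ-Reasoning
      open PS-Solver using (_:*_; _:=_)

  invₚ-cong-≈[] : ∀ N {f f′} → f ≈[ N ] f′ → invₚ f ≈[ N ] invₚ f′
  invₚ-cong-≈[] zero e zero z≤n = cong recip (e 0 z≤n)
  invₚ-cong-≈[] (suc N) {f} {f′} e i i≤1+N with ℕₚ.m≤n⇒m<n∨m≡n i≤1+N
  ... | inj₁ (s≤s i≤N) = invₚ-cong-≈[] N (≈[]-weaken e) i i≤N
  ... | inj₂ refl = begin
    invₚ f (suc N)                                                    ≡⟨ invₚ-suc f N ⟩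
    - (recip (f 0) * sumTo N (λ i → f (suc i) * invₚ f (N ∸ i)))     ≡⟨ cong₂ (λ a s → - (recip a * s)) (e 0 z≤n) (sumTo-cong-≤ N same-terms) ⟩
    - (recip (f′ 0) * sumTo N (λ i → f′ (suc i) * invₚ f′ (N ∸ i)))  ≡⟨ invₚ-suc f′ N ⟨
    invₚ f′ (suc N)                                                   ∎
    where
    open ≡-Reasoning
    same-terms : ∀ i → i ≤ N → f (suc i) * invₚ f (N ∸ i) ≡ f′ (suc i) * invₚ f′ (N ∸ i)
    same-terms i i≤N = cong₂ _*_ (e (suc i) (s≤s i≤N)) (invₚ-cong-≈[] N (≈[]-weaken e) (N ∸ i) (ℕₚ.m∸n≤m N i))


module SeriesSums where

  open import Defs
  open FiniteSums
  open PowerSeries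
  open import Data.Nat as ℕ using (ℕ; zero; suc; _≤_; _<_; z≤n; s≤s; _∸_)
  import Data.Nat.Properties as ℕₚ
  open import Data.Rational using (ℚ; 0ℚ; _+_; _*_)
  open import Data.Rational.Properties
  open import Data.Sum using (inj₁; inj₂)
  open import Function using (_∘_)
  open import Relation.Binary.PropositionalEquality

  OrderAtLeast : ℕ → PS → Set
  OrderAtLeast a f = ∀ t → t < a → f t ≡ 0ℚ

  OrderAtLeast-mono : ∀ {a b f} → b ≤ a → OrderAtLeast a f → OrderAtLeast b f
  OrderAtLeast-mono b≤a ord t t<b = ord t (ℕₚ.<-≤-trans t<b b≤a)

  OrderAtLeast-*ₚ : ∀ {a b f g} → OrderAtLeast a f → OrderAtLeast b g → OrderAtLeast (a ℕ.+ b) (f *ₚ g)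
  OrderAtLeast-*ₚ {a} {b} {f} {g} ord-f ord-g t t<a+b = sumTo-zero t _ term-vanishes
    where
    term-vanishes : ∀ i → i ≤ t → f i * g (t ∸ i) ≡ 0ℚ
    term-vanishes i i≤t with ℕₚ.<-≤-connex i a
    ... | inj₁ i<a = trans (cong (_* g (t ∸ i)) (ord-f i i<a)) (*-zeroˡ (g (t ∸ i)))
    ... | inj₂ a≤i = trans (cong (f i *_) (ord-g (t ∸ i) t∸i<b)) (*-zeroʳ (f i))
      where
      t∸i<b : t ∸ i < b
      t∸i<b = ℕₚ.+-cancelˡ-< i (t ∸ i) b
        (ℕₚ.≤-<-trans (ℕₚ.≤-reflexive (ℕₚ.m+[n∸m]≡n i≤t)) (ℕₚ.<-≤-trans t<a+b (ℕₚ.+-monoˡ-≤ b a≤i)))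

  OrderAtLeast-*ₚˡ : ∀ {b} f {g} → OrderAtLeast b g → OrderAtLeast b (f *ₚ g)
  OrderAtLeast-*ₚˡ f = OrderAtLeast-*ₚ {0} {f = f} (λ _ ())

  OrderAtLeast-^ₚ : ∀ {f} → OrderAtLeast 1 f → ∀ m → OrderAtLeast m (f ^ₚ m)
  OrderAtLeast-^ₚ ord zero _ ()
  OrderAtLeast-^ₚ ord (suc m) = OrderAtLeast-*ₚ ord (OrderAtLeast-^ₚ ord m)

  Summable : (ℕ → PS) → Set
  Summable g = ∀ N → OrderAtLeast N (g N)

  ∑ₚ : (ℕ → PS) → PS
  ∑ₚ g t = sumTo t (λ N → g N t)

  ∑ₚ-truncate : ∀ g → Summable g → ∀ t T → t ≤ T → sumTo T (λ N → g N t) ≡ ∑ₚ g t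
  ∑ₚ-truncate g summable t T t≤T =
    sym (sumTo-extend t T (λ N → g N t) t≤T (λ N t<N _ → summable N t t<N))

  ∑ₚ-cong : ∀ {g g′} → (∀ N → g N ≈ₚ g′ N) → ∑ₚ g ≈ₚ ∑ₚ g′
  ∑ₚ-cong e t = sumTo-cong t (λ N → e N t)

  ∑ₚ-distrib-+ₚ : ∀ g g′ → ∑ₚ (λ N → g N +ₚ g′ N) ≈ₚ ∑ₚ g +ₚ ∑ₚ g′
  ∑ₚ-distrib-+ₚ g g′ t = sumTo-distrib-+ t _ _

  *ₚ-distribˡ-∑ₚ : ∀ f g → Summable g → f *ₚ ∑ₚ g ≈ₚ ∑ₚ (λ N → f *ₚ g N)
  *ₚ-distribˡ-∑ₚ f g summable t = begin
    sumTo t (λ i → f i * ∑ₚ g (t ∸ i))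
      ≡⟨ sumTo-cong t (λ i → cong (f i *_) (sym (∑ₚ-truncate g summable (t ∸ i) t (ℕₚ.m∸n≤m t i)))) ⟩
    sumTo t (λ i → f i * sumTo t (λ N → g N (t ∸ i)))
      ≡⟨ sumTo-cong t (λ i → *-distribˡ-sumTo t (f i) _) ⟩
    sumTo t (λ i → sumTo t (λ N → f i * g N (t ∸ i)))
      ≡⟨ sumTo-comm t t _ ⟩
    ∑ₚ (λ N → f *ₚ g N) t ∎
    where open ≡-Reasoning

  ∑ₚ-head : ∀ g → Summable g → ∑ₚ g ≈ₚ g 0 +ₚ ∑ₚ (g ∘ suc)
  ∑ₚ-head g summable zero = begin
    g 0 0            ≡⟨ +-identityʳ (g 0 0) ⟨
    g 0 0 + 0ℚ       ≡⟨ cong (g 0 0 +_) (summable 1 0 (s≤s z≤n)) ⟨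
    g 0 0 + g 1 0    ∎
    where open ≡-Reasoning
  ∑ₚ-head g summable (suc t) = begin
    sumTo (suc t) (λ N → g N (suc t))              ≡⟨ sumTo-head t _ ⟩
    g 0 (suc t) + rest                             ≡⟨ cong (g 0 (suc t) +_) (+-identityʳ rest) ⟨
    g 0 (suc t) + (rest + 0ℚ)                      ≡⟨ cong (λ x → g 0 (suc t) + (rest + x)) last-vanishes ⟨
    g 0 (suc t) + (rest + g (suc (suc t)) (suc t)) ∎
    where
    open ≡-Reasoning
    rest : ℚ
    rest = sumTo t (λ N → g (suc N) (suc t))
    last-vanishes : g (suc (suc t)) (suc t) ≡ 0ℚ
    last-vanishes = summable (suc (suc t)) (suc t) ℕₚ.≤-refl


module CourseOfValues where

  open import Data.Nat using (ℕ; zero; suc; _≤_; _<_; z≤n; s≤s; _≤ᵇ_)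
  import Data.Nat.Properties as ℕₚ
  open import Data.Bool using (true; false; if_then_else_)
  open import Data.Sum using (inj₁; inj₂)
  open import Relation.Binary.PropositionalEquality

  module _ {I X : Set} (default : X) (step : ℕ → (ℕ → I → X) → I → X)
    (step-cong : ∀ n f g → (∀ m → m < n → ∀ i → f m i ≡ g m i) → ∀ i → step n f i ≡ step n g i) where

    private
      table : ℕ → ℕ → I → X
      table zero m = step zero (λ _ _ → default)
      table (suc n) m = if m ≤ᵇ n then table n m else step m (table n)

      suc-≰ᵇ : ∀ n → (suc n ≤ᵇ n) ≡ false
      suc-≰ᵇ zero = refl
      suc-≰ᵇ (suc n) = suc-≰ᵇ n

      ≤⇒≤ᵇ≡true : ∀ {m n} → m ≤ n → (m ≤ᵇ n) ≡ true
      ≤⇒≤ᵇ≡true {m} {n} m≤n with m ≤ᵇ n | ℕₚ.≤⇒≤ᵇ m≤n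
      ... | true | _ = refl

      table-stable : ∀ n m → m ≤ n → table n m ≡ table m m
      table-stable zero zero z≤n = refl
      table-stable (suc n) m m≤1+n with ℕₚ.m≤n⇒m<n∨m≡n m≤1+n
      ... | inj₂ refl = refl
      ... | inj₁ (s≤s m≤n) rewrite ≤⇒≤ᵇ≡true m≤n = table-stable n m m≤n

    fix : ℕ → I → X
    fix n = table n n

    fix-unfold : ∀ n i → fix n i ≡ step n fix i
    fix-unfold zero = step-cong zero _ fix (λ _ ())
    fix-unfold (suc n) rewrite suc-≰ᵇ n = step-cong (suc n) (table n) fix
      (λ m m<1+n i → cong (λ t → t i) (table-stable n m (ℕₚ.≤-pred m<1+n)))

    fix-unique : ∀ f → (∀ n i → f n i ≡ step n f i) → ∀ n i → f n i ≡ fix n i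
    fix-unique f f-unfold n = agree-below (suc n) n ℕₚ.≤-refl
      where
      agree-below : ∀ N m → m < N → ∀ i → f m i ≡ fix m i
      agree-below (suc N) m m<1+N i = begin
        f m i          ≡⟨ f-unfold m i ⟩
        step m f i     ≡⟨ step-cong m f fix (λ j j<m → agree-below N j (ℕₚ.<-≤-trans j<m (ℕₚ.≤-pred m<1+N))) i ⟩
        step m fix i   ≡⟨ fix-unfold m i ⟨
        fix m i        ∎
        where open ≡-Reasoning


module GrandSeries where

  open import Defs
  open FiniteSums
  open PowerSeries
  open Reciprocal
  open NatCast
  open CourseOfValues
  open import Data.Nat as ℕ using (ℕ; zero; suc; _<_)
  import Data.Nat.Properties as ℕₚ
  open import Data.Rational using (ℚ; 0ℚ; 1ℚ; _+_; _*_; _-_; -_)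
  open import Data.Rational.Properties
  open import Data.Unit using (⊤; tt)
  open import Relation.Nullary using (¬_)
  open import Relation.Binary.PropositionalEquality
  open import Tactic.RingSolver using (solve-∀)
  open PS-Solver using (solve; _:*_; _:-_; con; _:=_)

  constₚ-fromℕ-suc : ∀ k → constₚ (fromℕ (suc k)) ≈ₚ 1ₚ +ₚ constₚ (fromℕ k)
  constₚ-fromℕ-suc k zero = fromℕ-suc k
  constₚ-fromℕ-suc k (suc n) = refl

  module _ (k : ℕ) where

    Fib : PS
    Fib n = fromℕ (F k n)

    Pk-head : Pk k 0 ≡ 1ℚ
    Pk-head = simplify (fromℕ k)
      where
      simplify : ∀ a → 1ℚ - a * 0ℚ - 0ℚ * 0ℚ ≡ 1ℚ
      simplify = solve-∀ ℚ-ring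

    Pk-head≢0 : ¬ (Pk k 0 ≡ 0ℚ)
    Pk-head≢0 eq = 1≢0 (trans (sym Pk-head) eq)

    private
      κ : PS
      κ = constₚ (fromℕ k)

      drop-zeros : ∀ c a → c - a * 0ℚ - 0ℚ ≡ c
      drop-zeros = solve-∀ ℚ-ring

      Fib-recurrence : ∀ n → (Fib -ₚ κ *ₚ (zₚ *ₚ Fib) -ₚ zₚ *ₚ (zₚ *ₚ Fib)) n ≡ zₚ n
      Fib-recurrence zero = begin
        0ℚ - (κ *ₚ (zₚ *ₚ Fib)) 0 - (zₚ *ₚ (zₚ *ₚ Fib)) 0
          ≡⟨ cong₂ (λ a b → 0ℚ - a - b)
               (trans (constₚ-*ₚ (fromℕ k) (zₚ *ₚ Fib) 0) (cong (fromℕ k *_) (zₚ-*ₚ-zero Fib)))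
               (zₚ-*ₚ-zero (zₚ *ₚ Fib)) ⟩
        0ℚ - fromℕ k * 0ℚ - 0ℚ
          ≡⟨ drop-zeros 0ℚ (fromℕ k) ⟩
        0ℚ ∎
        where open ≡-Reasoning
      Fib-recurrence (suc zero) = begin
        1ℚ - (κ *ₚ (zₚ *ₚ Fib)) 1 - (zₚ *ₚ (zₚ *ₚ Fib)) 1
          ≡⟨ cong₂ (λ a b → 1ℚ - a - b)
               (trans (constₚ-*ₚ (fromℕ k) (zₚ *ₚ Fib) 1) (cong (fromℕ k *_) (zₚ-*ₚ-suc Fib 0)))
               (trans (zₚ-*ₚ-suc (zₚ *ₚ Fib) 0) (zₚ-*ₚ-zero Fib)) ⟩
        1ℚ - fromℕ k * 0ℚ - 0ℚ
          ≡⟨ drop-zeros 1ℚ (fromℕ k) ⟩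
        1ℚ ∎
        where open ≡-Reasoning
      Fib-recurrence (suc (suc n)) = begin
        fromℕ (k ℕ.* F k (suc n) ℕ.+ F k n) - (κ *ₚ (zₚ *ₚ Fib)) (suc (suc n)) - (zₚ *ₚ (zₚ *ₚ Fib)) (suc (suc n))
          ≡⟨ cong₂ _-_ (cong₂ _-_ recurrence kzF) z²F ⟩
        (fromℕ k * Fib (suc n) + Fib n) - fromℕ k * Fib (suc n) - Fib n
          ≡⟨ cancel (fromℕ k * Fib (suc n)) (Fib n) ⟩
        0ℚ ∎
        where
        open ≡-Reasoning
        recurrence : fromℕ (k ℕ.* F k (suc n) ℕ.+ F k n) ≡ fromℕ k * Fib (suc n) + Fib n
        recurrence = trans (fromℕ-+ (k ℕ.* F k (suc n)) (F k n)) (cong (_+ Fib n) (fromℕ-* k (F k (suc n))))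
        kzF : (κ *ₚ (zₚ *ₚ Fib)) (suc (suc n)) ≡ fromℕ k * Fib (suc n)
        kzF = trans (constₚ-*ₚ (fromℕ k) (zₚ *ₚ Fib) (suc (suc n))) (cong (fromℕ k *_) (zₚ-*ₚ-suc Fib (suc n)))
        z²F : (zₚ *ₚ (zₚ *ₚ Fib)) (suc (suc n)) ≡ Fib n
        z²F = trans (zₚ-*ₚ-suc (zₚ *ₚ Fib) (suc n)) (zₚ-*ₚ-suc Fib n)
        cancel : ∀ a b → (a + b) - a - b ≡ 0ℚ
        cancel = solve-∀ ℚ-ring

    Fib-*ₚ-Pk : Fib *ₚ Pk k ≈ₚ zₚ
    Fib-*ₚ-Pk = ≈ₚ-trans expand Fib-recurrence
      where
      expand : Fib *ₚ Pk k ≈ₚ Fib -ₚ κ *ₚ (zₚ *ₚ Fib) -ₚ zₚ *ₚ (zₚ *ₚ Fib)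
      expand = solve 3 (λ h c z → h :* (con 1ℚ :- c :* z :- z :* z) := h :- c :* (z :* h) :- z :* (z :* h))
        (λ _ → refl) Fib κ zₚ

    Fib≈z/Pk : Fib ≈ₚ zₚ *ₚ invₚ (Pk k)
    Fib≈z/Pk = begin
      Fib                              ≈⟨ *ₚ-identityʳ Fib ⟨
      Fib *ₚ 1ₚ                        ≈⟨ *ₚ-congˡ Fib (invₚ-inverseʳ (Pk k) Pk-head≢0) ⟨
      Fib *ₚ (Pk k *ₚ invₚ (Pk k))     ≈⟨ *ₚ-assoc Fib (Pk k) (invₚ (Pk k)) ⟨
      (Fib *ₚ Pk k) *ₚ invₚ (Pk k)     ≈⟨ *ₚ-congʳ (invₚ (Pk k)) Fib-*ₚ-Pk ⟩
      zₚ *ₚ invₚ (Pk k)                ∎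
      where open ≈ₚ-Reasoning

    private
      motzkin-rhs : PS → PS
      motzkin-rhs f = 1ₚ +ₚ Fib *ₚ f +ₚ zₚ *ₚ zₚ *ₚ (f *ₚ f)

      motzkin-step : ℕ → (ℕ → ⊤ → ℚ) → ⊤ → ℚ
      motzkin-step n f _ = motzkin-rhs (λ m → f m tt) n

      motzkin-step-cong : ∀ n f g → (∀ m → m < n → ∀ i → f m i ≡ g m i) → ∀ i → motzkin-step n f i ≡ motzkin-step n g i
      motzkin-step-cong n f g e _ = cong₂ _+_
        (cong (1ₚ n +_) (*ₚ-cong-below Fib n refl (λ m m<n → e m m<n tt)))
        (*ₚ-cong-below (zₚ *ₚ zₚ) n (*-zeroˡ 0ℚ) (λ m m<n →
          *ₚ-cong-≈[] m (below m<n) (below m<n) m ℕₚ.≤-refl))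
        where
        below : ∀ {m} → m < n → (λ j → f j tt) ≈[ m ] (λ j → g j tt)
        below m<n j j≤m = e j (ℕₚ.≤-<-trans j≤m m<n) tt

    Motzkin : PS
    Motzkin n = fix 0ℚ motzkin-step motzkin-step-cong n tt

    Motzkin-unfold : Motzkin ≈ₚ 1ₚ +ₚ Fib *ₚ Motzkin +ₚ zₚ *ₚ zₚ *ₚ (Motzkin *ₚ Motzkin)
    Motzkin-unfold n = fix-unfold 0ℚ motzkin-step motzkin-step-cong n tt

    Grand⁻¹ : PS
    Grand⁻¹ = 1ₚ -ₚ Fib -ₚ constₚ (fromℕ 2) *ₚ zₚ *ₚ zₚ *ₚ Motzkin

    Grand : PS
    Grand = invₚ Grand⁻¹

    Grand⁻¹-head : Grand⁻¹ 0 ≡ 1ℚ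
    Grand⁻¹-head = cong (λ x → 1ℚ - 0ℚ - x) (begin
      (two *ₚ zₚ *ₚ zₚ *ₚ Motzkin) 0                ≡⟨ solve 3 (λ c z m → c :* z :* z :* m := c :* (z :* z :* m)) (λ _ → refl) two zₚ Motzkin 0 ⟩
      fromℕ 2 * (zₚ *ₚ zₚ *ₚ Motzkin) 0             ≡⟨ cong (fromℕ 2 *_) (z²-*ₚ-zero Motzkin) ⟩
      fromℕ 2 * 0ℚ                                  ≡⟨ *-zeroʳ (fromℕ 2) ⟩
      0ℚ                                            ∎)
      where
      open ≡-Reasoning
      two : PS
      two = constₚ (fromℕ 2)

    Grand⁻¹-*ₚ-Grand : Grand⁻¹ *ₚ Grand ≈ₚ 1ₚ
    Grand⁻¹-*ₚ-Grand = invₚ-inverseʳ Grand⁻¹ (λ eq → 1≢0 (trans (sym Grand⁻¹-head) eq))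


module ClosedForm where

  open import Defs
  open PowerSeries
  open Reciprocal
  open NatCast
  open GrandSeries
  open import Data.Nat using (ℕ; suc)
  open import Data.Rational using (0ℚ; 1ℚ; _+_; _*_)
  open import Data.Rational.Properties
  open import Relation.Binary.PropositionalEquality
  open PS-Solver using (solve; _:+_; _:*_; _:-_; :-_; con; _:=_)

  module _ (k : ℕ) where

    private
      Φ M P : PS
      Φ = Fib k
      M = Motzkin k
      P = Pk k

    √Δ : PS
    √Δ = P *ₚ Grand⁻¹ k

    √Δ-head : √Δ 0 ≡ 1ℚ
    √Δ-head = trans (cong₂ _*_ (Pk-head k) (Grand⁻¹-head k)) (*-identityˡ 1ℚ)

    -- √Δ² − Δ is a combination of the three relations Fib·P = z, the equation of M, and
    -- const (k+1) = 1 + const k; the identity below exhibits the coefficients.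
    √Δ-squared : √Δ *ₚ √Δ ≈ₚ Δk k
    √Δ-squared n = begin
      (√Δ *ₚ √Δ) n                                         ≡⟨ in-ideal n ⟩
      (Δk k +ₚ (r₃ *ₚ b₃ +ₚ r₁ *ₚ b₁ +ₚ r₂ *ₚ b₂)) n
        ≡⟨ cong (Δk k n +_) (cong₂ _+_ (cong₂ _+_ (≈0ₚ-*ₚ r₃≈0 b₃ n) (≈0ₚ-*ₚ r₁≈0 b₁ n)) (≈0ₚ-*ₚ r₂≈0 b₂ n)) ⟩
      Δk k n + (0ℚ + 0ℚ + 0ℚ)                              ≡⟨ +-identityʳ (Δk k n) ⟩
      Δk k n                                               ∎
      where
      open ≡-Reasoning
      κ κ′ : PS
      κ = constₚ (fromℕ k)
      κ′ = constₚ (fromℕ (suc k))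
      r₁ r₂ r₃ b₁ b₂ b₃ : PS
      r₁ = Φ *ₚ P -ₚ zₚ
      r₂ = M -ₚ (1ₚ +ₚ Φ *ₚ M +ₚ zₚ *ₚ zₚ *ₚ (M *ₚ M))
      r₃ = κ′ -ₚ (1ₚ +ₚ κ)
      b₁ = r₁ -ₚ constₚ (fromℕ 2) *ₚ (P -ₚ zₚ)
      b₂ = negₚ (constₚ (fromℕ 4) *ₚ zₚ *ₚ zₚ *ₚ P *ₚ P)
      b₃ = constₚ (fromℕ 2) *ₚ (P -ₚ zₚ) *ₚ zₚ -ₚ zₚ *ₚ zₚ *ₚ r₃
      r₁≈0 : r₁ ≈ₚ 0ₚ
      r₁≈0 = -ₚ-≈0ₚ (Fib-*ₚ-Pk k)
      r₂≈0 : r₂ ≈ₚ 0ₚ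
      r₂≈0 = -ₚ-≈0ₚ (Motzkin-unfold k)
      r₃≈0 : r₃ ≈ₚ 0ₚ
      r₃≈0 = -ₚ-≈0ₚ (constₚ-fromℕ-suc k)
      in-ideal : √Δ *ₚ √Δ ≈ₚ Δk k +ₚ (r₃ *ₚ b₃ +ₚ r₁ *ₚ b₁ +ₚ r₂ *ₚ b₂)
      in-ideal = solve 5 (λ h m z c c′ →
         let p = con 1ℚ :- c :* z :- z :* z
             q = con 1ℚ :- c′ :* z :- z :* z
             two = con (fromℕ 2)
             four = con (fromℕ 4)
             e = con 1ℚ :- h :- two :* z :* z :* m
             ρ₁ = h :* p :- z
             ρ₂ = m :- (con 1ℚ :+ h :* m :+ z :* z :* (m :* m))
             ρ₃ = c′ :- (con 1ℚ :+ c)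
         in (p :* e) :* (p :* e) := (q :* q :- four :* z :* z :* p :* p) :+
              (ρ₃ :* (two :* (p :- z) :* z :- z :* z :* ρ₃) :+ ρ₁ :* (ρ₁ :- two :* (p :- z)) :+ ρ₂ :* (:- (four :* z :* z :* p :* p))))
         (λ _ → refl) Φ M zₚ κ κ′

    Grand-*ₚ-√Δ : Grand k *ₚ √Δ ≈ₚ P
    Grand-*ₚ-√Δ = begin
      Grand k *ₚ (P *ₚ Grand⁻¹ k)     ≈⟨ solve 3 (λ t p e → t :* (p :* e) := p :* (e :* t)) (λ _ → refl) (Grand k) P (Grand⁻¹ k) ⟩
      P *ₚ (Grand⁻¹ k *ₚ Grand k)     ≈⟨ *ₚ-congˡ P (Grand⁻¹-*ₚ-Grand k) ⟩
      P *ₚ 1ₚ                         ≈⟨ *ₚ-identityʳ P ⟩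
      P                               ∎
      where open ≈ₚ-Reasoning


module ContinuedFraction where

  open import Defs
  open PowerSeries
  open Reciprocal
  open GrandSeries
  open import Data.Nat as ℕ using (ℕ; zero; suc; _≤_; s≤s)
  import Data.Nat.Properties as ℕₚ
  open import Data.Rational using (0ℚ; 1ℚ; _-_)
  open import Relation.Nullary using (¬_)
  open import Data.Rational.Properties
  open import Data.Product using (_,_)
  open import Relation.Binary.PropositionalEquality
  open PS-Solver using (solve; _:+_; _:*_; _:-_; con; _:=_)

  module _ (k : ℕ) where

    private
      M : PS
      M = Motzkin k

    aₖ≈1-Fib : aₖ k ≈ₚ 1ₚ -ₚ Fib k
    aₖ≈1-Fib n = cong (1ₚ n -_) (sym (Fib≈z/Pk k n))

    -- M = 1/(a − z²M): the continued fraction is the expansion of this fixed point.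
    Motzkin⁻¹ : PS
    Motzkin⁻¹ = aₖ k -ₚ zₚ *ₚ zₚ *ₚ M

    Motzkin⁻¹-*ₚ-Motzkin : Motzkin⁻¹ *ₚ M ≈ₚ 1ₚ
    Motzkin⁻¹-*ₚ-Motzkin = begin
      Motzkin⁻¹ *ₚ M
        ≈⟨ *ₚ-congʳ M (λ n → cong (_- (zₚ *ₚ zₚ *ₚ M) n) (aₖ≈1-Fib n)) ⟩
      (1ₚ -ₚ Fib k -ₚ zₚ *ₚ zₚ *ₚ M) *ₚ M
        ≈⟨ solve 3 (λ h m z → (con 1ℚ :- h :- z :* z :* m) :* m := con 1ℚ :+ (m :- (con 1ℚ :+ h :* m :+ z :* z :* (m :* m))))
             (λ _ → refl) (Fib k) M zₚ ⟩
      1ₚ +ₚ (M -ₚ (1ₚ +ₚ Fib k *ₚ M +ₚ zₚ *ₚ zₚ *ₚ (M *ₚ M)))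
        ≈⟨ +ₚ-cong (≈ₚ-refl {1ₚ}) (-ₚ-≈0ₚ (Motzkin-unfold k)) ⟩
      1ₚ +ₚ 0ₚ
        ≈⟨ (λ n → +-identityʳ (1ₚ n)) ⟩
      1ₚ ∎
      where open ≈ₚ-Reasoning

    Motzkin≈inv : M ≈ₚ invₚ Motzkin⁻¹
    Motzkin≈inv = invₚ-unique Motzkin⁻¹ M Motzkin⁻¹-head≢0 Motzkin⁻¹-*ₚ-Motzkin
      where
      Motzkin⁻¹-head≢0 : ¬ (Motzkin⁻¹ 0 ≡ 0ℚ)
      Motzkin⁻¹-head≢0 eq = 1≢0 (trans (sym head) eq)
        where
        head : Motzkin⁻¹ 0 ≡ 1ℚ
        head = cong₂ _-_ (aₖ≈1-Fib 0) (z²-*ₚ-zero M)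

    -- Each level of the continued fraction fixes two more coefficients.
    Kₖ-≈[] : ∀ j → Kₖ k j ≈[ suc (2 ℕ.* j) ] Motzkin⁻¹
    invₚ-Kₖ-≈[] : ∀ j → invₚ (Kₖ k j) ≈[ suc (2 ℕ.* j) ] M

    Kₖ-≈[] zero zero _ = sym (trans (cong (aₖ k 0 -_) (z²-*ₚ-zero M)) (+-identityʳ (aₖ k 0)))
    Kₖ-≈[] zero (suc zero) _ = sym (trans (cong (aₖ k 1 -_) (z²-*ₚ-one M)) (+-identityʳ (aₖ k 1)))
    Kₖ-≈[] zero (suc (suc i)) (s≤s ())
    Kₖ-≈[] (suc j) rewrite ℕₚ.*-suc 2 j =
      -ₚ-cong-≈[] _ {aₖ k} (λ _ _ → refl) (z²-*ₚ-cong-≈[] (suc (2 ℕ.* j)) (invₚ-Kₖ-≈[] j))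

    invₚ-Kₖ-≈[] j = ≈[]-trans (invₚ-cong-≈[] _ (Kₖ-≈[] j)) (λ i _ → sym (Motzkin≈inv i))

    private
      two : PS
      two = constₚ (fromℕ 2)

      2z²-*ₚ-cong-≈[] : ∀ N {f g} → f ≈[ N ] g → two *ₚ zₚ *ₚ zₚ *ₚ f ≈[ suc (suc N) ] two *ₚ zₚ *ₚ zₚ *ₚ g
      2z²-*ₚ-cong-≈[] N {f} {g} e i i≤N+2 = begin
        (two *ₚ zₚ *ₚ zₚ *ₚ f) i   ≡⟨ reassoc f i ⟩
        (two *ₚ (zₚ *ₚ zₚ *ₚ f)) i ≡⟨ *ₚ-cong-≈[] _ {two} (λ _ _ → refl) (z²-*ₚ-cong-≈[] N e) i i≤N+2 ⟩
        (two *ₚ (zₚ *ₚ zₚ *ₚ g)) i ≡⟨ reassoc g i ⟨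
        (two *ₚ zₚ *ₚ zₚ *ₚ g) i   ∎
        where
        open ≡-Reasoning
        reassoc : ∀ h → two *ₚ zₚ *ₚ zₚ *ₚ h ≈ₚ two *ₚ (zₚ *ₚ zₚ *ₚ h)
        reassoc h = solve 3 (λ c z x → c :* z :* z :* x := c :* (z :* z :* x)) (λ _ → refl) two zₚ h

    cfTrunc-≈[] : ∀ j → cfTrunc k j ≈[ suc (suc (suc (2 ℕ.* j))) ] Grand k
    cfTrunc-≈[] j = invₚ-cong-≈[] _ (-ₚ-cong-≈[] _ (λ i _ → aₖ≈1-Fib i) (2z²-*ₚ-cong-≈[] _ (invₚ-Kₖ-≈[] j)))

    cfTrunc-converges : ConvergesTo (cfTrunc k) (Grand k)
    cfTrunc-converges N = N , λ j N≤j n n≤N → cfTrunc-≈[] j n (ℕₚ.≤-trans n≤N (ℕₚ.≤-trans N≤j (j≤bound j)))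
      where
      j≤bound : ∀ j → j ≤ suc (suc (suc (2 ℕ.* j)))
      j≤bound j = ℕₚ.≤-trans (ℕₚ.m≤n*m j 2) (ℕₚ.m≤n+m (2 ℕ.* j) 3)

  ConvergesTo-respʳ : ∀ {c T T′} → T ≈ₚ T′ → ConvergesTo c T → ConvergesTo c T′
  ConvergesTo-respʳ T≈T′ converges N with converges N
  ... | J , agree = J , λ j J≤j n n≤N → trans (agree j J≤j n n≤N) (T≈T′ n)


module PathCounting where

  open import Defs
  open CourseOfValues
  open import Data.Nat.Induction using (<-rec)
  open import Data.Nat as ℕ using (ℕ; zero; suc; _≤_; _<_; z≤n; s≤s; _∸_)
  import Data.Nat.Properties as ℕₚ
  open import Data.Integer as ℤ using (ℤ; +_; -[1+_])
  import Data.Integer.Properties as ℤₚ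
  open import Data.Integer.Tactic.RingSolver using (solve-∀)
  open import Data.Fin using (Fin)
  open import Data.Fin.Properties using (+↔⊎; *↔×; 0↔⊥; 1↔⊤)
  open import Data.Fin.Permutation using (↔⇒≡)
  open import Data.List using (List; []; _∷_)
  open import Data.Product using (Σ; _×_; _,_)
  open import Data.Sum using (_⊎_; inj₁; inj₂)
  open import Data.Empty using (⊥; ⊥-elim)
  open import Function.Bundles using (_↔_; mk↔ₛ′; Inverse)
  open import Function.Properties.Inverse using (↔-refl; ↔-sym; ↔-trans)
  open import Data.Sum.Function.Propositional using (_⊎-↔_)
  open import Data.Product.Function.NonDependent.Propositional using (_×-↔_)
  open import Function using (_∘_)
  open import Relation.Binary.PropositionalEquality
  open import Axiom.UniquenessOfIdentityProofs using (module Decidable⇒UIP)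

  sumℕ : ℕ → (ℕ → ℕ) → ℕ
  sumℕ zero g = g 0
  sumℕ (suc n) g = sumℕ n g ℕ.+ g (suc n)

  sumℕ-cong-≤ : ∀ n {g g′} → (∀ l → l ≤ n → g l ≡ g′ l) → sumℕ n g ≡ sumℕ n g′
  sumℕ-cong-≤ zero e = e 0 z≤n
  sumℕ-cong-≤ (suc n) e = cong₂ ℕ._+_ (sumℕ-cong-≤ n (λ l l≤n → e l (ℕₚ.m≤n⇒m≤1+n l≤n))) (e (suc n) ℕₚ.≤-refl)

  Bounded : ℕ → (ℕ → Set) → Set
  Bounded n B = Σ ℕ (λ l → l ≤ n × B l)

  Bounded-zero↔ : ∀ B → Bounded 0 B ↔ B 0
  Bounded-zero↔ B = mk↔ₛ′ to (λ b → 0 , z≤n , b) (λ _ → refl) from∘to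
    where
    to : Bounded 0 B → B 0
    to (zero , z≤n , b) = b
    from∘to : ∀ x → (0 , z≤n , to x) ≡ x
    from∘to (zero , z≤n , b) = refl

  Bounded-suc↔ : ∀ n B → Bounded (suc n) B ↔ (Bounded n B ⊎ B (suc n))
  Bounded-suc↔ n B = mk↔ₛ′ to from to∘from from∘to
    where
    to : Bounded (suc n) B → Bounded n B ⊎ B (suc n)
    to (l , l≤1+n , b) with ℕₚ.m≤n⇒m<n∨m≡n l≤1+n
    ... | inj₁ (s≤s l≤n) = inj₁ (l , l≤n , b)
    ... | inj₂ refl = inj₂ b
    from : Bounded n B ⊎ B (suc n) → Bounded (suc n) B
    from (inj₁ (l , l≤n , b)) = l , ℕₚ.m≤n⇒m≤1+n l≤n , b
    from (inj₂ b) = suc n , ℕₚ.≤-refl , b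
    to∘from : ∀ y → to (from y) ≡ y
    to∘from (inj₁ (l , l≤n , b)) with ℕₚ.m≤n⇒m<n∨m≡n (ℕₚ.m≤n⇒m≤1+n l≤n)
    ... | inj₁ (s≤s l≤n′) = cong (λ p → inj₁ (l , p , b)) (ℕₚ.≤-irrelevant l≤n′ l≤n)
    ... | inj₂ refl = ⊥-elim (ℕₚ.<-irrefl refl l≤n)
    to∘from (inj₂ b) with ℕₚ.m≤n⇒m<n∨m≡n (ℕₚ.≤-refl {suc n})
    ... | inj₁ 1+n<1+n = ⊥-elim (ℕₚ.<-irrefl refl 1+n<1+n)
    ... | inj₂ refl = refl
    from∘to : ∀ x → from (to x) ≡ x
    from∘to (l , l≤1+n , b) with ℕₚ.m≤n⇒m<n∨m≡n l≤1+n
    ... | inj₁ (s≤s l≤n) = cong (λ p → l , p , b) (ℕₚ.≤-irrelevant _ l≤1+n)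
    ... | inj₂ refl = cong (λ p → suc n , p , b) (ℕₚ.≤-irrelevant _ l≤1+n)

  Bounded-cong : ∀ n {B B′ : ℕ → Set} → (∀ l → B l ↔ B′ l) → Bounded n B ↔ Bounded n B′
  Bounded-cong n e = mk↔ₛ′
    (λ { (l , l≤n , b) → l , l≤n , Inverse.to (e l) b })
    (λ { (l , l≤n , b) → l , l≤n , Inverse.from (e l) b })
    (λ { (l , l≤n , b) → cong (λ x → l , l≤n , x) (Inverse.strictlyInverseˡ (e l) b) })
    (λ { (l , l≤n , b) → cong (λ x → l , l≤n , x) (Inverse.strictlyInverseʳ (e l) b) })

  Bounded-Fin↔ : ∀ n g → Bounded n (λ l → Fin (g l)) ↔ Fin (sumℕ n g)
  Bounded-Fin↔ zero g = Bounded-zero↔ (λ l → Fin (g l))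
  Bounded-Fin↔ (suc n) g =
    ↔-trans (Bounded-suc↔ n _) (↔-trans (Bounded-Fin↔ n g ⊎-↔ ↔-refl) (↔-sym +↔⊎))

  Paths : ℕ → ℕ → ℤ → Set
  Paths k n h = Σ (List (Step k)) (λ s → (pathLength s ≡ n) × (pathHeight s ≡ h))

  -- Height at which the rest of a path must end after a first step U or D.
  below above : ℤ → ℤ
  below h = h ℤ.+ -[1+ 0 ]
  above h = h ℤ.+ + 1

  isZero : ℤ → ℕ
  isZero (+ zero) = 1
  isZero (+ suc _) = 0
  isZero -[1+ _ ] = 0

  ℤ-≡-irrelevant : ∀ {a b : ℤ} (p q : a ≡ b) → p ≡ q
  ℤ-≡-irrelevant = Decidable⇒UIP.≡-irrelevant ℤₚ._≟_

  module _ {k : ℕ} where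

    private
      Paths-≡ : ∀ {n h} {s : List (Step k)} {p p′ : pathLength s ≡ n} {q q′ : pathHeight s ≡ h} →
        _≡_ {A = Paths k n h} (s , p , q) (s , p′ , q′)
      Paths-≡ {p = p} {p′} {q} {q′} =
        cong₂ (λ a b → _ , a , b) (ℕₚ.≡-irrelevant p p′) (ℤ-≡-irrelevant q q′)

      nonempty-length : ∀ (x : Step k) (s : List (Step k)) → stepLength x ℕ.+ pathLength s ≡ 0 → ⊥
      nonempty-length U s ()
      nonempty-length D s ()
      nonempty-length (H l c) s ()

      rest-below : ∀ {x h} → + 1 ℤ.+ x ≡ h → x ≡ below h
      rest-below {x} eq = trans (cancel x) (cong (ℤ._+ -[1+ 0 ]) eq)
        where
        cancel : ∀ x → x ≡ (+ 1 ℤ.+ x) ℤ.+ -[1+ 0 ]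
        cancel = solve-∀

      rest-below⁻¹ : ∀ {x h} → x ≡ below h → + 1 ℤ.+ x ≡ h
      rest-below⁻¹ {h = h} eq = trans (cong (λ y → + 1 ℤ.+ y) eq) (cancel h)
        where
        cancel : ∀ h → + 1 ℤ.+ (h ℤ.+ -[1+ 0 ]) ≡ h
        cancel = solve-∀

      rest-above : ∀ {x h} → -[1+ 0 ] ℤ.+ x ≡ h → x ≡ above h
      rest-above {x} eq = trans (cancel x) (cong (ℤ._+ + 1) eq)
        where
        cancel : ∀ x → x ≡ (-[1+ 0 ] ℤ.+ x) ℤ.+ + 1
        cancel = solve-∀

      rest-above⁻¹ : ∀ {x h} → x ≡ above h → -[1+ 0 ] ℤ.+ x ≡ h
      rest-above⁻¹ {h = h} eq = trans (cong (λ y → -[1+ 0 ] ℤ.+ y) eq) (cancel h)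
        where
        cancel : ∀ h → -[1+ 0 ] ℤ.+ (h ℤ.+ + 1) ≡ h
        cancel = solve-∀

      rest-length : ∀ {l x n} → suc l ℕ.+ x ≡ suc n → l ≤ n × x ≡ n ∸ l
      rest-length {l} {x} refl = ℕₚ.m≤m+n l x , sym (ℕₚ.m+n∸m≡n l x)

      rest-length⁻¹ : ∀ {l x n} → l ≤ n → x ≡ n ∸ l → suc l ℕ.+ x ≡ suc n
      rest-length⁻¹ l≤n refl = cong suc (ℕₚ.m+[n∸m]≡n l≤n)

    Paths-zero↔ : ∀ h → Paths k 0 h ↔ Fin (isZero h)
    Paths-zero↔ h = ↔-trans (mk↔ₛ′ to (λ eq → [] , refl , eq) (λ _ → ℤ-≡-irrelevant _ _) from∘to) (zero-height↔ h)
      where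
      to : Paths k 0 h → + 0 ≡ h
      to ([] , _ , eq) = eq
      to (x ∷ s , len , _) = ⊥-elim (nonempty-length x s len)
      from∘to : ∀ p → ([] , refl , to p) ≡ p
      from∘to ([] , _ , _) = Paths-≡
      from∘to (x ∷ s , len , _) = ⊥-elim (nonempty-length x s len)
      zero-height↔ : ∀ h → (+ 0 ≡ h) ↔ Fin (isZero h)
      zero-height↔ (+ zero) = ↔-trans (mk↔ₛ′ _ (λ _ → refl) (λ _ → refl) (λ _ → ℤ-≡-irrelevant _ _)) (↔-sym 1↔⊤)
      zero-height↔ (+ suc m) = ↔-trans (mk↔ₛ′ (λ ()) (λ ()) (λ ()) (λ ())) (↔-sym 0↔⊥)
      zero-height↔ -[1+ m ] = ↔-trans (mk↔ₛ′ (λ ()) (λ ()) (λ ()) (λ ())) (↔-sym 0↔⊥)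

    FirstStep : ℕ → ℤ → Set
    FirstStep n h = Paths k n (below h) ⊎ (Paths k n (above h) ⊎ Bounded n (λ l → Fin (F k (suc l)) × Paths k (n ∸ l) h))

    Paths-suc↔ : ∀ n h → Paths k (suc n) h ↔ FirstStep n h
    Paths-suc↔ n h = mk↔ₛ′ to from to∘from from∘to
      where
      to : Paths k (suc n) h → FirstStep n h
      to ([] , () , _)
      to (U ∷ s , len , ht) = inj₁ (s , ℕₚ.suc-injective len , rest-below ht)
      to (D ∷ s , len , ht) = inj₂ (inj₁ (s , ℕₚ.suc-injective len , rest-above ht))
      to (H l c ∷ s , len , ht) with rest-length len
      ... | l≤n , len′ = inj₂ (inj₂ (l , l≤n , c , s , len′ , trans (sym (ℤₚ.+-identityˡ _)) ht))
      from : FirstStep n h → Paths k (suc n) h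
      from (inj₁ (s , len , ht)) = U ∷ s , cong suc len , rest-below⁻¹ ht
      from (inj₂ (inj₁ (s , len , ht))) = D ∷ s , cong suc len , rest-above⁻¹ ht
      from (inj₂ (inj₂ (l , l≤n , c , s , len , ht))) = H l c ∷ s , rest-length⁻¹ l≤n len , trans (ℤₚ.+-identityˡ _) ht
      to∘from : ∀ y → to (from y) ≡ y
      to∘from (inj₁ _) = cong inj₁ Paths-≡
      to∘from (inj₂ (inj₁ _)) = cong (inj₂ ∘ inj₁) Paths-≡
      to∘from (inj₂ (inj₂ (l , l≤n , c , s , len , ht))) =
        cong₂ (λ p q → inj₂ (inj₂ (l , p , c , q))) (ℕₚ.≤-irrelevant _ l≤n) Paths-≡
      from∘to : ∀ x → from (to x) ≡ x
      from∘to ([] , () , _)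
      from∘to (U ∷ s , _ , _) = Paths-≡
      from∘to (D ∷ s , _ , _) = Paths-≡
      from∘to (H l c ∷ s , _ , _) = Paths-≡

    private
      count-step : ℕ → (ℕ → ℤ → ℕ) → ℤ → ℕ
      count-step zero f h = isZero h
      count-step (suc n) f h = f n (below h) ℕ.+ (f n (above h) ℕ.+ sumℕ n (λ l → F k (suc l) ℕ.* f (n ∸ l) h))

      count-step-cong : ∀ n f g → (∀ m → m < n → ∀ h → f m h ≡ g m h) → ∀ h → count-step n f h ≡ count-step n g h
      count-step-cong zero f g e h = refl
      count-step-cong (suc n) f g e h = cong₂ ℕ._+_ (e n ℕₚ.≤-refl (below h)) (cong₂ ℕ._+_ (e n ℕₚ.≤-refl (above h))
        (sumℕ-cong-≤ n (λ l _ → cong (F k (suc l) ℕ.*_) (e (n ∸ l) (s≤s (ℕₚ.m∸n≤m n l)) h))))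

    count : ℕ → ℤ → ℕ
    count = fix 0 count-step count-step-cong

    count-unfold : ∀ n h → count n h ≡ count-step n count h
    count-unfold = fix-unfold 0 count-step count-step-cong

    Paths↔count : ∀ n h → Paths k n h ↔ Fin (count n h)
    Paths↔count = <-rec (λ n → ∀ h → Paths k n h ↔ Fin (count n h)) by-first-step
      where
      by-first-step : ∀ n → (∀ {m} → m < n → ∀ h → Paths k m h ↔ Fin (count m h)) → ∀ h → Paths k n h ↔ Fin (count n h)
      by-first-step zero _ h = subst (λ c → Paths k 0 h ↔ Fin c) (sym (count-unfold 0 h)) (Paths-zero↔ h)
      by-first-step (suc n) IH h = subst (λ c → Paths k (suc n) h ↔ Fin c) (sym (count-unfold (suc n) h))
        (↔-trans (Paths-suc↔ n h)
        (↔-trans (IH ℕₚ.≤-refl (below h) ⊎-↔ (IH ℕₚ.≤-refl (above h) ⊎-↔ horizontal))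
                 (↔-trans (↔-refl ⊎-↔ ↔-sym +↔⊎) (↔-sym +↔⊎))))
        where
        horizontal : Bounded n (λ l → Fin (F k (suc l)) × Paths k (n ∸ l) h) ↔ Fin (sumℕ n (λ l → F k (suc l) ℕ.* count (n ∸ l) h))
        horizontal = ↔-trans
          (Bounded-cong n (λ l → ↔-trans (↔-refl ×-↔ IH (s≤s (ℕₚ.m∸n≤m n l)) h) (↔-sym *↔×)))
          (Bounded-Fin↔ n _)

    card≡count : (card : ℕ → ℕ) → (∀ i → GrandPath k i ↔ Fin (card i)) → ∀ i → card i ≡ count i (+ 0)
    card≡count card card-iso i = ↔⇒≡ (↔-trans (↔-sym (card-iso i)) (Paths↔count i (+ 0)))


module HeightSystem where

  open import Defs
  open FiniteSums
  open PowerSeries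
  open NatCast
  open CourseOfValues
  open GrandSeries
  open PathCounting
  open import Data.Nat as ℕ using (ℕ; zero; suc; _<_; s≤s; _∸_)
  import Data.Nat.Properties as ℕₚ
  open import Data.Integer using (ℤ; +_; -[1+_]; ∣_∣)
  open import Data.Rational using (ℚ; 0ℚ; 1ℚ; _+_; _*_)
  open import Data.Rational.Properties
  open import Data.Fin using (Fin)
  open import Data.Product using (_×_; _,_)
  open import Function.Bundles using (_↔_)
  open import Relation.Binary.PropositionalEquality
  open import Tactic.RingSolver using (solve-∀)

  fromℕ-sumℕ : ∀ n g → fromℕ (sumℕ n g) ≡ sumTo n (λ l → fromℕ (g l))
  fromℕ-sumℕ zero g = refl
  fromℕ-sumℕ (suc n) g = trans (fromℕ-+ (sumℕ n g) (g (suc n))) (cong (_+ fromℕ (g (suc n))) (fromℕ-sumℕ n g))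

  module _ (k : ℕ) where

    -- G j is meant to count paths ending at height ±j; the equations split off the first step.
    HeightSystem : (ℕ → PS) → Set
    HeightSystem G =
      (G 0 ≈ₚ 1ₚ +ₚ (zₚ *ₚ G 1 +ₚ (zₚ *ₚ G 1 +ₚ Fib k *ₚ G 0))) ×
      (∀ j → G (suc j) ≈ₚ zₚ *ₚ G j +ₚ (zₚ *ₚ G (suc (suc j)) +ₚ Fib k *ₚ G (suc j)))

    private
      step : ℕ → (ℕ → ℤ → ℚ) → ℤ → ℚ
      step zero f h = fromℕ (isZero h)
      step (suc n) f h = f n (below h) + (f n (above h) + sumTo n (λ l → Fib k (suc l) * f (n ∸ l) h))

      step-cong : ∀ n f g → (∀ m → m < n → ∀ h → f m h ≡ g m h) → ∀ h → step n f h ≡ step n g h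
      step-cong zero f g e h = refl
      step-cong (suc n) f g e h = cong₂ _+_ (e n ℕₚ.≤-refl (below h)) (cong₂ _+_ (e n ℕₚ.≤-refl (above h))
        (sumTo-cong-≤ n (λ l _ → cong (Fib k (suc l) *_) (e (n ∸ l) (s≤s (ℕₚ.m∸n≤m n l)) h))))

      count-solves : ∀ n h → fromℕ (count {k} n h) ≡ step n (λ m h → fromℕ (count {k} m h)) h
      count-solves zero h = cong fromℕ (count-unfold {k} 0 h)
      count-solves (suc n) h = begin
        fromℕ (count (suc n) h)                               ≡⟨ cong fromℕ (count-unfold (suc n) h) ⟩
        fromℕ (up ℕ.+ (down ℕ.+ sumℕ n g))                    ≡⟨ fromℕ-+ up (down ℕ.+ sumℕ n g) ⟩
        fromℕ up + fromℕ (down ℕ.+ sumℕ n g)                  ≡⟨ cong (λ x → fromℕ up + x) (fromℕ-+ down (sumℕ n g)) ⟩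
        fromℕ up + (fromℕ down + fromℕ (sumℕ n g))            ≡⟨ cong (λ x → fromℕ up + (fromℕ down + x)) horizontal ⟩
        step (suc n) (λ m h → fromℕ (count {k} m h)) h        ∎
        where
        open ≡-Reasoning
        up down : ℕ
        up = count {k} n (below h)
        down = count {k} n (above h)
        g : ℕ → ℕ
        g l = F k (suc l) ℕ.* count {k} (n ∸ l) h
        horizontal : fromℕ (sumℕ n g) ≡ sumTo n (λ l → Fib k (suc l) * fromℕ (count {k} (n ∸ l) h))
        horizontal = trans (fromℕ-sumℕ n g) (sumTo-cong n (λ l → fromℕ-* (F k (suc l)) (count (n ∸ l) h)))

      ∣above+∣ : ∀ j → ∣ above (+ suc j) ∣ ≡ suc (suc j)
      ∣above+∣ j = cong suc (ℕₚ.+-comm j 1)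

      ∣below-∣ : ∀ j → ∣ below -[1+ j ] ∣ ≡ suc (suc j)
      ∣below-∣ j = cong (λ x → suc (suc x)) (ℕₚ.+-identityʳ j)

      ∣above-∣ : ∀ j → ∣ above -[1+ j ] ∣ ≡ j
      ∣above-∣ zero = refl
      ∣above-∣ (suc j) = refl

      Fib-*ₚ-suc : ∀ g n → (Fib k *ₚ g) (suc n) ≡ sumTo n (λ l → Fib k (suc l) * g (n ∸ l))
      Fib-*ₚ-suc g n = begin
        (Fib k *ₚ g) (suc n)       ≡⟨ sumTo-head n (λ i → Fib k i * g (suc n ∸ i)) ⟩
        0ℚ * g (suc n) + rest      ≡⟨ cong (_+ rest) (*-zeroˡ (g (suc n))) ⟩
        0ℚ + rest                  ≡⟨ +-identityˡ rest ⟩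
        rest                       ∎
        where
        open ≡-Reasoning
        rest : ℚ
        rest = sumTo n (λ l → Fib k (suc l) * g (n ∸ l))

      first-step : ∀ (G : ℕ → PS) j n → (zₚ *ₚ G j +ₚ (zₚ *ₚ G (suc (suc j)) +ₚ Fib k *ₚ G (suc j))) (suc n)
        ≡ G j n + (G (suc (suc j)) n + sumTo n (λ l → Fib k (suc l) * G (suc j) (n ∸ l)))
      first-step G j n = cong₂ _+_ (zₚ-*ₚ-suc (G j) n) (cong₂ _+_ (zₚ-*ₚ-suc (G (suc (suc j))) n) (Fib-*ₚ-suc (G (suc j)) n))

      system-solves : ∀ G → HeightSystem G → ∀ n h → G ∣ h ∣ n ≡ step n (λ m h → G ∣ h ∣ m) h
      system-solves G (eq₀ , eq₊) zero (+ zero) = trans (eq₀ 0)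
        (cong (λ x → 1ℚ + x) (cong₂ _+_ (zₚ-*ₚ-zero (G 1)) (cong₂ _+_ (zₚ-*ₚ-zero (G 1)) (*-zeroˡ (G 0 0)))))
      system-solves G (eq₀ , eq₊) zero (+ suc j) = trans (eq₊ j 0)
        (cong₂ _+_ (zₚ-*ₚ-zero (G j)) (cong₂ _+_ (zₚ-*ₚ-zero (G (suc (suc j)))) (*-zeroˡ (G (suc j) 0))))
      system-solves G eqs zero -[1+ j ] = system-solves G eqs zero (+ suc j)
      system-solves G (eq₀ , eq₊) (suc n) (+ zero) = trans (eq₀ (suc n))
        (trans (cong (λ x → 0ℚ + x) (cong₂ _+_ (zₚ-*ₚ-suc (G 1) n) (cong₂ _+_ (zₚ-*ₚ-suc (G 1) n) (Fib-*ₚ-suc (G 0) n)))) (+-identityˡ _))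
      system-solves G (eq₀ , eq₊) (suc n) (+ suc j) = trans (eq₊ j (suc n)) (trans (first-step G j n)
        (cong (λ i → G j n + (G i n + horizontal)) (sym (∣above+∣ j))))
        where horizontal = sumTo n (λ l → Fib k (suc l) * G (suc j) (n ∸ l))
      system-solves G (eq₀ , eq₊) (suc n) -[1+ j ] = trans (eq₊ j (suc n)) (trans (first-step G j n)
        (trans (swap (G j n) (G (suc (suc j)) n) horizontal)
          (cong₂ (λ i i′ → G i n + (G i′ n + horizontal)) (sym (∣below-∣ j)) (sym (∣above-∣ j)))))
        where
        horizontal = sumTo n (λ l → Fib k (suc l) * G (suc j) (n ∸ l))
        swap : ∀ a b c → a + (b + c) ≡ b + (a + c)
        swap = solve-∀ ℚ-ring

    HeightSystem⇒count : ∀ G → HeightSystem G → ∀ n h → fromℕ (count {k} n h) ≡ G ∣ h ∣ n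
    HeightSystem⇒count G system n h = trans
      (fix-unique 0ℚ step step-cong _ count-solves n h)
      (sym (fix-unique 0ℚ step step-cong _ (system-solves G system) n h))

    HeightSystem⇒card : ∀ G → HeightSystem G → (card : ℕ → ℕ) → (∀ i → GrandPath k i ↔ Fin (card i)) → ∀ i → fromℕ (card i) ≡ G 0 i
    HeightSystem⇒card G system card card-iso i =
      trans (cong fromℕ (card≡count card card-iso i)) (HeightSystem⇒count G system i (+ 0))


module GrandCount where

  open import Defs
  open PowerSeries
  open GrandSeries
  open HeightSystem
  open import Data.Nat using (ℕ; suc)
  open import Data.Rational using (1ℚ)
  open import Data.Fin using (Fin)
  open import Data.Product using (_,_)
  open import Function.Bundles using (_↔_)
  open import Relation.Binary.PropositionalEquality
  open PS-Solver using (solve; _:+_; _:*_; _:-_; con; _:=_)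

  module _ (k : ℕ) where

    private
      M T Φ : PS
      M = Motzkin k
      T = Grand k
      Φ = Fib k

    -- A path ending at height j > 0 splits at its last visits to the heights 0, …, j − 1 into a
    -- grand path followed by j times an up step and a Motzkin path.
    grand-levels : ℕ → PS
    grand-levels j = T *ₚ (zₚ *ₚ M) ^ₚ j

    grand-levels-system : HeightSystem k grand-levels
    grand-levels-system = level-zero , level-suc
      where
      level-zero : grand-levels 0 ≈ₚ 1ₚ +ₚ (zₚ *ₚ grand-levels 1 +ₚ (zₚ *ₚ grand-levels 1 +ₚ Φ *ₚ grand-levels 0))
      level-zero = ≈ₚ-modulo
        (solve 4 (λ t z m h → t :* con 1ℚ :=
          con 1ℚ :+ (z :* (t :* ((z :* m) :* con 1ℚ)) :+ (z :* (t :* ((z :* m) :* con 1ℚ)) :+ h :* (t :* con 1ℚ))) :+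
          ((con 1ℚ :- h :- con (fromℕ 2) :* z :* z :* m) :* t :- con 1ℚ))
          (λ _ → refl) T zₚ M Φ)
        (-ₚ-≈0ₚ (Grand⁻¹-*ₚ-Grand k))
      level-suc : ∀ j → grand-levels (suc j) ≈ₚ zₚ *ₚ grand-levels j +ₚ (zₚ *ₚ grand-levels (suc (suc j)) +ₚ Φ *ₚ grand-levels (suc j))
      level-suc j = ≈ₚ-modulo
        (solve 5 (λ t z m y h → t :* ((z :* m) :* y) :=
          (z :* (t :* y) :+ (z :* (t :* ((z :* m) :* ((z :* m) :* y))) :+ h :* (t :* ((z :* m) :* y)))) :+
          (t :* z :* y) :* (m :- (con 1ℚ :+ h :* m :+ z :* z :* (m :* m))))
          (λ _ → refl) T zₚ M ((zₚ *ₚ M) ^ₚ j) Φ)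
        (*ₚ-≈0ₚ (T *ₚ zₚ *ₚ (zₚ *ₚ M) ^ₚ j) (-ₚ-≈0ₚ (Motzkin-unfold k)))

    card≈Grand : (card : ℕ → ℕ) → (∀ i → GrandPath k i ↔ Fin (card i)) → (λ i → fromℕ (card i)) ≈ₚ Grand k
    card≈Grand card card-iso i =
      trans (HeightSystem⇒card k grand-levels grand-levels-system card card-iso i) (*ₚ-identityʳ T i)


module Binomials where

  open import Defs using (fromℕ; sumTo)
  open FiniteSums
  open NatCast
  open import Data.Nat as ℕ using (ℕ; zero; suc; _≤_; _∸_)
  import Data.Nat.Properties as ℕₚ
  open import Data.Nat.Combinatorics using (_C_; nCk+nC[k+1]≡[n+1]C[k+1]; nCk≡nC[n∸k]; nC1≡n)
  import Data.Nat.Tactic.RingSolver as ℕ-Solver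
  open import Data.Integer as ℤ using ()
  open import Data.Rational using (ℚ; 0ℚ; 1ℚ; _+_; _*_; _-_; _/_)
  open import Data.Rational.Properties
  open import Relation.Nullary using (¬_)
  open import Relation.Binary.PropositionalEquality
  open import Tactic.RingSolver using (solve-∀)

  absorption : ∀ n k → suc k ℕ.* (suc n C suc k) ≡ suc n ℕ.* (n C k)
  absorption zero zero = refl
  absorption zero (suc k) = ℕₚ.*-zeroʳ (suc (suc k))
  absorption (suc n) zero = trans (ℕₚ.*-identityˡ _) (trans (nC1≡n (suc (suc n))) (sym (ℕₚ.*-identityʳ (suc (suc n)))))
  absorption (suc n) (suc k) = begin
    suc (suc k) ℕ.* (suc (suc n) C suc (suc k))  ≡⟨ cong (suc (suc k) ℕ.*_) (pascal (suc n) (suc k)) ⟨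
    suc (suc k) ℕ.* (c ℕ.+ d)                     ≡⟨ distribute (suc k) c d ⟩
    suc k ℕ.* c ℕ.+ c ℕ.+ suc (suc k) ℕ.* d       ≡⟨ cong₂ (λ x y → x ℕ.+ c ℕ.+ y) (absorption n k) (absorption n (suc k)) ⟩
    suc n ℕ.* a ℕ.+ c ℕ.+ suc n ℕ.* b            ≡⟨ cong (λ x → suc n ℕ.* a ℕ.+ x ℕ.+ suc n ℕ.* b) (pascal n k) ⟨
    suc n ℕ.* a ℕ.+ (a ℕ.+ b) ℕ.+ suc n ℕ.* b    ≡⟨ collect (suc n) a b ⟩
    suc (suc n) ℕ.* (a ℕ.+ b)                    ≡⟨ cong (suc (suc n) ℕ.*_) (pascal n k) ⟩
    suc (suc n) ℕ.* c                            ∎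
    where
    open ≡-Reasoning
    pascal = nCk+nC[k+1]≡[n+1]C[k+1]
    a = n C k
    b = n C suc k
    c = suc n C suc k
    d = suc n C suc (suc k)
    distribute : ∀ x y z → suc x ℕ.* (y ℕ.+ z) ≡ x ℕ.* y ℕ.+ y ℕ.+ suc x ℕ.* z
    distribute = ℕ-Solver.solve-∀
    collect : ∀ x y z → x ℕ.* y ℕ.+ (y ℕ.+ z) ℕ.+ x ℕ.* z ≡ suc x ℕ.* (y ℕ.+ z)
    collect = ℕ-Solver.solve-∀

  binomial : ℕ → ℕ → ℚ
  binomial n k = fromℕ (n C k)

  binomial-pascal : ∀ n k → binomial (suc n) (suc k) ≡ binomial n k + binomial n (suc k)
  binomial-pascal n k = trans (cong fromℕ (sym (nCk+nC[k+1]≡[n+1]C[k+1] n k))) (fromℕ-+ (n C k) (n C suc k))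

  binomial-sym : ∀ a b → binomial (a ℕ.+ b) a ≡ binomial (a ℕ.+ b) b
  binomial-sym a b = cong fromℕ (trans (nCk≡nC[n∸k] (ℕₚ.m≤m+n a b)) (cong ((a ℕ.+ b) C_) (ℕₚ.m+n∸m≡n a b)))

  -- ballot p m is the ballot number p/(p+2m)·C(p+2m, m) (and [m ≡ 0] for p = 0),
  -- written as C(p+2m−1, m) − C(p+2m−1, m−1) to avoid the division.
  ballot : ℕ → ℕ → ℚ
  ballot zero zero = 1ℚ
  ballot zero (suc m) = 0ℚ
  ballot (suc p) zero = 1ℚ
  ballot (suc p) (suc m) = binomial (2 ℕ.+ p ℕ.+ 2 ℕ.* m) (suc m) - binomial (2 ℕ.+ p ℕ.+ 2 ℕ.* m) m

  ballot-zero : ∀ p → ballot p 0 ≡ 1ℚ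
  ballot-zero zero = refl
  ballot-zero (suc p) = refl

  ballot-rec : ∀ p m → ballot (suc p) (suc m) ≡ ballot p (suc m) + ballot (suc (suc p)) m
  ballot-rec zero zero = refl
  ballot-rec zero (suc m) = begin
    binomial (2 ℕ.+ 0 ℕ.+ 2 ℕ.* suc m) (suc (suc m)) - binomial (2 ℕ.+ 0 ℕ.+ 2 ℕ.* suc m) (suc m)
      ≡⟨ cong (λ x → binomial x (suc (suc m)) - binomial x (suc m)) (size m) ⟩
    binomial (suc n) (suc (suc m)) - binomial (suc n) (suc m)
      ≡⟨ cong₂ _-_ (binomial-pascal n (suc m)) (binomial-pascal n m) ⟩
    (binomial n (suc m) + binomial n (suc (suc m))) - (binomial n m + binomial n (suc m))
      ≡⟨ cong (λ x → (binomial n (suc m) + x) - (binomial n m + binomial n (suc m))) middle ⟩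
    (binomial n (suc m) + binomial n (suc m)) - (binomial n m + binomial n (suc m))
      ≡⟨ cancel (binomial n (suc m)) (binomial n m) ⟩
    0ℚ + (binomial n (suc m) - binomial n m) ∎
    where
    open ≡-Reasoning
    n = 2 ℕ.+ 1 ℕ.+ 2 ℕ.* m
    size : ∀ m → 2 ℕ.+ 0 ℕ.+ 2 ℕ.* suc m ≡ suc (2 ℕ.+ 1 ℕ.+ 2 ℕ.* m)
    size = ℕ-Solver.solve-∀
    split : ∀ m → 2 ℕ.+ 1 ℕ.+ 2 ℕ.* m ≡ suc m ℕ.+ suc (suc m)
    split = ℕ-Solver.solve-∀
    middle : binomial n (suc (suc m)) ≡ binomial n (suc m)
    middle = begin
      binomial n (suc (suc m))                            ≡⟨ cong (λ x → binomial x (suc (suc m))) (split m) ⟩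
      binomial (suc m ℕ.+ suc (suc m)) (suc (suc m))      ≡⟨ binomial-sym (suc m) (suc (suc m)) ⟨
      binomial (suc m ℕ.+ suc (suc m)) (suc m)            ≡⟨ cong (λ x → binomial x (suc m)) (split m) ⟨
      binomial n (suc m)                                  ∎
    cancel : ∀ a c → (a + a) - (c + a) ≡ 0ℚ + (a - c)
    cancel = solve-∀ ℚ-ring
  ballot-rec (suc p) zero = begin
    binomial (2 ℕ.+ suc p ℕ.+ 0) 1 - 1ℚ            ≡⟨ cong (_- 1ℚ) (trans (cong fromℕ (nC1≡n (2 ℕ.+ suc p ℕ.+ 0))) (fromℕ-suc (2 ℕ.+ p ℕ.+ 0))) ⟩
    (1ℚ + fromℕ (2 ℕ.+ p ℕ.+ 0)) - 1ℚ              ≡⟨ rearrange (fromℕ (2 ℕ.+ p ℕ.+ 0)) ⟩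
    (fromℕ (2 ℕ.+ p ℕ.+ 0) - 1ℚ) + 1ℚ              ≡⟨ cong (λ x → (fromℕ x - 1ℚ) + 1ℚ) (nC1≡n (2 ℕ.+ p ℕ.+ 0)) ⟨
    (binomial (2 ℕ.+ p ℕ.+ 0) 1 - 1ℚ) + 1ℚ         ∎
    where
    open ≡-Reasoning
    rearrange : ∀ a → (1ℚ + a) - 1ℚ ≡ (a - 1ℚ) + 1ℚ
    rearrange = solve-∀ ℚ-ring
  ballot-rec (suc p) (suc m) = begin
    binomial (suc n) (suc (suc m)) - binomial (suc n) (suc m)
      ≡⟨ cong₂ _-_ (binomial-pascal n (suc m)) (binomial-pascal n m) ⟩
    (binomial n (suc m) + binomial n (suc (suc m))) - (binomial n m + binomial n (suc m))
      ≡⟨ telescope (binomial n m) (binomial n (suc m)) (binomial n (suc (suc m))) ⟩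
    (binomial n (suc (suc m)) - binomial n (suc m)) + (binomial n (suc m) - binomial n m)
      ≡⟨ cong (λ x → (binomial n (suc (suc m)) - binomial n (suc m)) + (binomial x (suc m) - binomial x m)) (size p m) ⟨
    ballot (suc p) (suc (suc m)) + ballot (suc (suc (suc p))) (suc m) ∎
    where
    open ≡-Reasoning
    n = 2 ℕ.+ p ℕ.+ 2 ℕ.* suc m
    size : ∀ p m → 2 ℕ.+ suc (suc p) ℕ.+ 2 ℕ.* m ≡ 2 ℕ.+ p ℕ.+ 2 ℕ.* suc m
    size = ℕ-Solver.solve-∀
    telescope : ∀ c a b → (a + b) - (c + a) ≡ (b - a) + (a - c)
    telescope = solve-∀ ℚ-ring

  module _ (X Y : ℕ → ℕ → ℚ)
    (X-zero : ∀ j → X j 0 ≡ 1ℚ) (Y-zero : ∀ j → Y j 0 ≡ 1ℚ)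
    (X-edge : ∀ N → X 0 (suc N) ≡ fromℕ 2 * X 1 N) (Y-edge : ∀ N → Y 0 (suc N) ≡ fromℕ 2 * Y 1 N)
    (X-rec : ∀ j N → X (suc j) (suc N) ≡ X j (suc N) + X (suc (suc j)) N)
    (Y-rec : ∀ j N → Y (suc j) (suc N) ≡ Y j (suc N) + Y (suc (suc j)) N) where

    ballot-table-unique : ∀ N j → X j N ≡ Y j N
    ballot-table-unique zero j = trans (X-zero j) (sym (Y-zero j))
    ballot-table-unique (suc N) zero =
      trans (X-edge N) (trans (cong (fromℕ 2 *_) (ballot-table-unique N 1)) (sym (Y-edge N)))
    ballot-table-unique (suc N) (suc j) =
      trans (X-rec j N) (trans (cong₂ _+_ (ballot-table-unique (suc N) j) (ballot-table-unique N (suc (suc j)))) (sym (Y-rec j N)))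

  ballot-sum : ℕ → ℕ → ℚ
  ballot-sum j N = sumTo N (λ n → fromℕ (2 ℕ.^ n) * ballot (n ℕ.+ j) (N ∸ n))

  shifted-central : ℕ → ℕ → ℚ
  shifted-central j N = binomial (2 ℕ.* N ℕ.+ j) N

  ballot-sum-edge : ∀ N → ballot-sum 0 (suc N) ≡ fromℕ 2 * ballot-sum 1 N
  ballot-sum-edge N = begin
    sumTo (suc N) f                                                       ≡⟨ sumTo-head N f ⟩
    f 0 + sumTo N (λ n → f (suc n))                                       ≡⟨ cong₂ _+_ (*-zeroʳ 1ℚ) (sumTo-cong N term) ⟩
    0ℚ + sumTo N (λ n → fromℕ 2 * (fromℕ (2 ℕ.^ n) * ballot (n ℕ.+ 1) (N ∸ n))) ≡⟨ +-identityˡ _ ⟩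
    sumTo N (λ n → fromℕ 2 * (fromℕ (2 ℕ.^ n) * ballot (n ℕ.+ 1) (N ∸ n)))      ≡⟨ *-distribˡ-sumTo N (fromℕ 2) _ ⟨
    fromℕ 2 * ballot-sum 1 N                                              ∎
    where
    open ≡-Reasoning
    f = λ n → fromℕ (2 ℕ.^ n) * ballot (n ℕ.+ 0) (suc N ∸ n)
    term : ∀ n → f (suc n) ≡ fromℕ 2 * (fromℕ (2 ℕ.^ n) * ballot (n ℕ.+ 1) (N ∸ n))
    term n = trans (cong₂ _*_ (fromℕ-* 2 (2 ℕ.^ n)) (cong (λ x → ballot x (N ∸ n)) (trans (ℕₚ.+-identityʳ (suc n)) (ℕₚ.+-comm 1 n))))
                   (*-assoc (fromℕ 2) (fromℕ (2 ℕ.^ n)) (ballot (n ℕ.+ 1) (N ∸ n)))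

  ballot-sum-rec : ∀ j N → ballot-sum (suc j) (suc N) ≡ ballot-sum j (suc N) + ballot-sum (suc (suc j)) N
  ballot-sum-rec j N = begin
    sumTo N f + f (suc N)                            ≡⟨ cong₂ _+_ (trans (sumTo-cong-≤ N split) (sumTo-distrib-+ N g h)) (last (suc j)) ⟩
    (sumTo N g + sumTo N h) + fromℕ (2 ℕ.^ suc N)    ≡⟨ swap (sumTo N g) (sumTo N h) _ ⟩
    (sumTo N g + fromℕ (2 ℕ.^ suc N)) + sumTo N h    ≡⟨ cong (λ x → (sumTo N g + x) + sumTo N h) (last j) ⟨
    (sumTo N g + g (suc N)) + sumTo N h             ∎
    where
    open ≡-Reasoning
    f = λ n → fromℕ (2 ℕ.^ n) * ballot (n ℕ.+ suc j) (suc N ∸ n)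
    g = λ n → fromℕ (2 ℕ.^ n) * ballot (n ℕ.+ j) (suc N ∸ n)
    h = λ n → fromℕ (2 ℕ.^ n) * ballot (n ℕ.+ suc (suc j)) (N ∸ n)
    split : ∀ n → n ≤ N → f n ≡ g n + h n
    split n n≤N = trans (cong (fromℕ (2 ℕ.^ n) *_) (begin
      ballot (n ℕ.+ suc j) (suc N ∸ n)                 ≡⟨ cong₂ ballot (ℕₚ.+-suc n j) (ℕₚ.+-∸-assoc 1 n≤N) ⟩
      ballot (suc (n ℕ.+ j)) (suc (N ∸ n))             ≡⟨ ballot-rec (n ℕ.+ j) (N ∸ n) ⟩
      ballot (n ℕ.+ j) (suc (N ∸ n)) + ballot (suc (suc (n ℕ.+ j))) (N ∸ n)
        ≡⟨ cong₂ _+_ (cong (ballot (n ℕ.+ j)) (sym (ℕₚ.+-∸-assoc 1 n≤N)))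
                     (cong (λ x → ballot x (N ∸ n)) (sym (trans (ℕₚ.+-suc n (suc j)) (cong suc (ℕₚ.+-suc n j))))) ⟩
      ballot (n ℕ.+ j) (suc N ∸ n) + ballot (n ℕ.+ suc (suc j)) (N ∸ n) ∎))
      (*-distribˡ-+ (fromℕ (2 ℕ.^ n)) _ _)
    last : ∀ i → fromℕ (2 ℕ.^ suc N) * ballot (suc N ℕ.+ i) (suc N ∸ suc N) ≡ fromℕ (2 ℕ.^ suc N)
    last i = trans (cong (fromℕ (2 ℕ.^ suc N) *_) (trans (cong (ballot (suc N ℕ.+ i)) (ℕₚ.n∸n≡0 N)) (ballot-zero (suc N ℕ.+ i)))) (*-identityʳ _)
    swap : ∀ a b c → (a + b) + c ≡ (a + c) + b
    swap = solve-∀ ℚ-ring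

  shifted-central-edge : ∀ N → shifted-central 0 (suc N) ≡ fromℕ 2 * shifted-central 1 N
  shifted-central-edge N = begin
    binomial (2 ℕ.* suc N ℕ.+ 0) (suc N)      ≡⟨ cong (λ x → binomial x (suc N)) (size N) ⟩
    binomial (suc m) (suc N)                  ≡⟨ binomial-pascal m N ⟩
    binomial m N + binomial m (suc N)         ≡⟨ cong (binomial m N +_) middle ⟩
    binomial m N + binomial m N               ≡⟨ double (binomial m N) ⟩
    fromℕ 2 * binomial m N                    ∎
    where
    open ≡-Reasoning
    m = 2 ℕ.* N ℕ.+ 1
    size : ∀ N → 2 ℕ.* suc N ℕ.+ 0 ≡ suc (2 ℕ.* N ℕ.+ 1)
    size = ℕ-Solver.solve-∀
    split : ∀ N → 2 ℕ.* N ℕ.+ 1 ≡ N ℕ.+ suc N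
    split = ℕ-Solver.solve-∀
    middle : binomial m (suc N) ≡ binomial m N
    middle = begin
      binomial m (suc N)                 ≡⟨ cong (λ x → binomial x (suc N)) (split N) ⟩
      binomial (N ℕ.+ suc N) (suc N)     ≡⟨ binomial-sym N (suc N) ⟨
      binomial (N ℕ.+ suc N) N           ≡⟨ cong (λ x → binomial x N) (split N) ⟨
      binomial m N                       ∎
    double : ∀ a → a + a ≡ fromℕ 2 * a
    double a = trans (cong₂ _+_ (sym (*-identityˡ a)) (sym (*-identityˡ a))) (sym (*-distribʳ-+ a 1ℚ 1ℚ))

  shifted-central-rec : ∀ j N → shifted-central (suc j) (suc N) ≡ shifted-central j (suc N) + shifted-central (suc (suc j)) N
  shifted-central-rec j N = begin
    binomial (2 ℕ.* suc N ℕ.+ suc j) (suc N)            ≡⟨ cong (λ x → binomial x (suc N)) (ℕₚ.+-suc (2 ℕ.* suc N) j) ⟩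
    binomial (suc s) (suc N)                            ≡⟨ binomial-pascal s N ⟩
    binomial s N + binomial s (suc N)                   ≡⟨ +-comm (binomial s N) (binomial s (suc N)) ⟩
    binomial s (suc N) + binomial s N                   ≡⟨ cong (λ x → binomial s (suc N) + binomial x N) (size N j) ⟨
    binomial s (suc N) + binomial (2 ℕ.* N ℕ.+ suc (suc j)) N ∎
    where
    open ≡-Reasoning
    s = 2 ℕ.* suc N ℕ.+ j
    size : ∀ N j → 2 ℕ.* N ℕ.+ suc (suc j) ≡ 2 ℕ.* suc N ℕ.+ j
    size = ℕ-Solver.solve-∀

  ballot-sum≡shifted-central : ∀ j N → ballot-sum j N ≡ shifted-central j N
  ballot-sum≡shifted-central j N = ballot-table-unique ballot-sum shifted-central
    (λ j → trans (*-identityˡ (ballot j 0)) (ballot-zero j)) (λ _ → refl)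
    ballot-sum-edge shifted-central-edge ballot-sum-rec shifted-central-rec N j

  binomial-absorption : ∀ a m → fromℕ (suc m) * binomial (suc a) (suc m) ≡ fromℕ (suc a) * binomial a m
  binomial-absorption a m =
    trans (sym (fromℕ-* (suc m) (suc a C suc m))) (trans (cong fromℕ (absorption a m)) (fromℕ-* (suc a) (a C m)))

  ballot-difference : ∀ p m → let a = p ℕ.+ 2 ℕ.* suc m in
    fromℕ (suc m) * (binomial a (suc m) - binomial a m) ≡ fromℕ (suc p) * binomial a m
  ballot-difference p m = begin
    m′ * (Y - X)                           ≡⟨ cong (m′ *_) (expand X Y) ⟩
    m′ * ((X + Y) - X - X)                 ≡⟨ cong (λ b → m′ * (b - X - X)) (binomial-pascal a m) ⟨
    m′ * (binomial (suc a) (suc m) - X - X)   ≡⟨ distribute m′ (binomial (suc a) (suc m)) X ⟩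
    m′ * binomial (suc a) (suc m) - fromℕ 2 * m′ * X ≡⟨ cong (_- fromℕ 2 * m′ * X) (binomial-absorption a m) ⟩
    a′ * X - fromℕ 2 * m′ * X              ≡⟨ cong (λ d → d * X - fromℕ 2 * m′ * X) a′-split ⟩
    (p′ + fromℕ 2 * m′) * X - fromℕ 2 * m′ * X ≡⟨ cancel p′ (fromℕ 2 * m′) X ⟩
    p′ * X                                 ∎
    where
    open ≡-Reasoning
    a = p ℕ.+ 2 ℕ.* suc m
    X = binomial a m
    Y = binomial a (suc m)
    p′ = fromℕ (suc p)
    m′ = fromℕ (suc m)
    a′ = fromℕ (suc a)
    a′-split : a′ ≡ p′ + fromℕ 2 * m′
    a′-split = trans (fromℕ-+ (suc p) (2 ℕ.* suc m)) (cong (p′ +_) (fromℕ-* 2 (suc m)))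
    expand : ∀ x y → y - x ≡ (x + y) - x - x
    expand = solve-∀ ℚ-ring
    distribute : ∀ x b c → x * (b - c - c) ≡ x * b - fromℕ 2 * x * c
    distribute = solve-∀ ℚ-ring
    cancel : ∀ x y c → (x + y) * c - y * c ≡ x * c
    cancel = solve-∀ ℚ-ring

  ballot-closed-form : ∀ p m → ((ℤ.+ suc p) / (suc p ℕ.+ 2 ℕ.* m)) * binomial (suc p ℕ.+ 2 ℕ.* m) m ≡ ballot (suc p) m
  ballot-closed-form p zero = trans (*-identityʳ q) q≡1
    where
    q = (ℤ.+ suc p) / (suc p ℕ.+ 2 ℕ.* 0)
    q≡1 : q ≡ 1ℚ
    q≡1 = *-cancelʳ-≢0 q 1ℚ (fromℕ (suc (p ℕ.+ 0))) (fromℕ-suc≢0 (p ℕ.+ 0))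
      (trans (/-*-fromℕ (suc p) (p ℕ.+ 0)) (trans (cong (λ x → fromℕ (suc x)) (sym (ℕₚ.+-identityʳ p))) (sym (*-identityˡ _))))
  ballot-closed-form p (suc m) = trans
    (*-cancelʳ-≢0 (q * binomial (suc a) (suc m)) (Y - X) (m′ * a′) m′a′≢0 (begin
      q * binomial (suc a) (suc m) * (m′ * a′)   ≡⟨ regroup q (binomial (suc a) (suc m)) m′ a′ ⟩
      (q * a′) * (m′ * binomial (suc a) (suc m)) ≡⟨ cong₂ _*_ (/-*-fromℕ (suc p) a) (binomial-absorption a m) ⟩
      p′ * (a′ * X)                              ≡⟨ swap p′ a′ X ⟩
      a′ * (p′ * X)                              ≡⟨ cong (a′ *_) (ballot-difference p m) ⟨
      a′ * (m′ * (Y - X))                        ≡⟨ swap′ a′ m′ (Y - X) ⟩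
      (Y - X) * (m′ * a′)                        ∎))
    (cong (λ x → binomial x (suc m) - binomial x m) (size p m))
    where
    open ≡-Reasoning
    size : ∀ p m → p ℕ.+ 2 ℕ.* suc m ≡ 2 ℕ.+ p ℕ.+ 2 ℕ.* m
    size = ℕ-Solver.solve-∀
    a = p ℕ.+ 2 ℕ.* suc m
    q = (ℤ.+ suc p) / suc a
    X = binomial a m
    Y = binomial a (suc m)
    p′ = fromℕ (suc p)
    m′ = fromℕ (suc m)
    a′ = fromℕ (suc a)
    m′a′≢0 : ¬ (m′ * a′ ≡ 0ℚ)
    m′a′≢0 eq = fromℕ-suc≢0 (a ℕ.+ m ℕ.* suc a) (trans (fromℕ-* (suc m) (suc a)) eq)
    regroup : ∀ q b s d → (q * b) * (s * d) ≡ (q * d) * (s * b)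
    regroup = solve-∀ ℚ-ring
    swap : ∀ x y z → x * (y * z) ≡ y * (x * z)
    swap = solve-∀ ℚ-ring
    swap′ : ∀ x y z → x * (y * z) ≡ z * (y * x)
    swap′ = solve-∀ ℚ-ring


module CentralSeries where

  open import Defs
  open PowerSeries
  open SeriesSums
  open Binomials
  open import Data.Nat as ℕ using (ℕ; zero; suc; s≤s)
  import Data.Nat.Properties as ℕₚ
  import Data.Nat.Tactic.RingSolver as ℕ-Solver
  open import Data.Rational using (1ℚ; _+_; _*_)
  open import Data.Rational.Properties
  open import Function using (_∘_)
  open import Relation.Binary.PropositionalEquality
  open PS-Solver using (solve; _:*_; _:=_)

  module _ (u : PS) (u-order : OrderAtLeast 1 u) where

    central-term : ℕ → ℕ → PS
    central-term j N = constₚ (shifted-central j N) *ₚ u ^ₚ (2 ℕ.* N ℕ.+ j)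

    central-term-summable : ∀ j → Summable (central-term j)
    central-term-summable j N = OrderAtLeast-*ₚˡ (constₚ (shifted-central j N))
      (OrderAtLeast-mono (ℕₚ.≤-trans (ℕₚ.m≤m+n N (N ℕ.+ 0)) (ℕₚ.m≤m+n (2 ℕ.* N) j)) (OrderAtLeast-^ₚ u-order _))

    central : ℕ → PS
    central j = ∑ₚ (central-term j)

    private
      scaled-power-cong : ∀ {a b} e {e′} → a ≡ b → e ≡ e′ → constₚ a *ₚ u ^ₚ e ≈ₚ constₚ b *ₚ u ^ₚ e′
      scaled-power-cong e refl refl = ≈ₚ-refl

      scaled-power-+ : ∀ a b e → constₚ a *ₚ u ^ₚ e +ₚ constₚ b *ₚ u ^ₚ e ≈ₚ constₚ (a + b) *ₚ u ^ₚ e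
      scaled-power-+ a b e n = begin
        (constₚ a *ₚ u ^ₚ e) n + (constₚ b *ₚ u ^ₚ e) n   ≡⟨ cong₂ _+_ (constₚ-*ₚ a (u ^ₚ e) n) (constₚ-*ₚ b (u ^ₚ e) n) ⟩
        a * (u ^ₚ e) n + b * (u ^ₚ e) n                   ≡⟨ *-distribʳ-+ ((u ^ₚ e) n) a b ⟨
        (a + b) * (u ^ₚ e) n                              ≡⟨ constₚ-*ₚ (a + b) (u ^ₚ e) n ⟨
        (constₚ (a + b) *ₚ u ^ₚ e) n                      ∎
        where open ≡-Reasoning

      u-*ₚ-central-term : ∀ j N → u *ₚ central-term j N ≈ₚ constₚ (shifted-central j N) *ₚ u ^ₚ suc (2 ℕ.* N ℕ.+ j)
      u-*ₚ-central-term j N = solve 3 (λ x c U → x :* (c :* U) := c :* (x :* U)) (λ _ → refl) u (constₚ (shifted-central j N)) (u ^ₚ (2 ℕ.* N ℕ.+ j))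

      u-*ₚ-central : ∀ j → u *ₚ central j ≈ₚ ∑ₚ (λ N → constₚ (shifted-central j N) *ₚ u ^ₚ suc (2 ℕ.* N ℕ.+ j))
      u-*ₚ-central j = ≈ₚ-trans (*ₚ-distribˡ-∑ₚ u (central-term j) (central-term-summable j)) (∑ₚ-cong (u-*ₚ-central-term j))

      -- u·C (j+2), re-indexed so that its N-th term has the exponent 2N+j+1 of the others.
      shifted : ℕ → ℕ → PS
      shifted j zero = 0ₚ
      shifted j (suc N) = constₚ (shifted-central (suc (suc j)) N) *ₚ u ^ₚ suc (2 ℕ.* N ℕ.+ suc (suc j))

      u-*ₚ-central-shifted : ∀ j → u *ₚ central (suc (suc j)) ≈ₚ ∑ₚ (shifted j)
      u-*ₚ-central-shifted j = begin
        u *ₚ central (suc (suc j))   ≈⟨ u-*ₚ-central (suc (suc j)) ⟩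
        ∑ₚ (shifted j ∘ suc)          ≈⟨ (λ n → +-identityˡ _) ⟨
        0ₚ +ₚ ∑ₚ (shifted j ∘ suc)    ≈⟨ ∑ₚ-head (shifted j) summable ⟨
        ∑ₚ (shifted j)                ∎
        where
        open ≈ₚ-Reasoning
        summable : Summable (shifted j)
        summable zero _ ()
        summable (suc N) = OrderAtLeast-*ₚˡ (constₚ (shifted-central (suc (suc j)) N))
          (OrderAtLeast-mono (s≤s (ℕₚ.≤-trans (ℕₚ.m≤m+n N (N ℕ.+ 0)) (ℕₚ.m≤m+n (2 ℕ.* N) (suc (suc j))))) (OrderAtLeast-^ₚ u-order _))

    central-suc : ∀ j → central (suc j) ≈ₚ u *ₚ central j +ₚ u *ₚ central (suc (suc j))
    central-suc j = begin
      central (suc j)                                                   ≈⟨ ∑ₚ-cong pascal ⟩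
      ∑ₚ (λ N → constₚ (shifted-central j N) *ₚ u ^ₚ suc (2 ℕ.* N ℕ.+ j) +ₚ shifted j N)
                                                                        ≈⟨ ∑ₚ-distrib-+ₚ _ _ ⟩
      ∑ₚ (λ N → constₚ (shifted-central j N) *ₚ u ^ₚ suc (2 ℕ.* N ℕ.+ j)) +ₚ ∑ₚ (shifted j)
                                                                        ≈⟨ +ₚ-cong (u-*ₚ-central j) (u-*ₚ-central-shifted j) ⟨
      u *ₚ central j +ₚ u *ₚ central (suc (suc j))                      ∎
      where
      open ≈ₚ-Reasoning
      pascal : ∀ N → central-term (suc j) N ≈ₚ constₚ (shifted-central j N) *ₚ u ^ₚ suc (2 ℕ.* N ℕ.+ j) +ₚ shifted j N
      pascal zero n = sym (+-identityʳ _)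
      pascal (suc N) = ≈ₚ-sym (≈ₚ-trans
        (+ₚ-cong (scaled-power-cong (suc (2 ℕ.* suc N ℕ.+ j)) refl (sym (ℕₚ.+-suc (2 ℕ.* suc N) j)))
                 (scaled-power-cong (suc (2 ℕ.* N ℕ.+ suc (suc j))) refl (size N j)))
        (≈ₚ-trans (scaled-power-+ (shifted-central j (suc N)) (shifted-central (suc (suc j)) N) (2 ℕ.* suc N ℕ.+ suc j))
                  (scaled-power-cong (2 ℕ.* suc N ℕ.+ suc j) (sym (shifted-central-rec j N)) refl)))
        where
        size : ∀ N j → suc (2 ℕ.* N ℕ.+ suc (suc j)) ≡ 2 ℕ.* suc N ℕ.+ suc j
        size = ℕ-Solver.solve-∀

    private
      shifted-central-doubled : ∀ N → shifted-central 1 N + shifted-central 1 N ≡ shifted-central 0 (suc N)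
      shifted-central-doubled N = begin
        shifted-central 1 N + shifted-central 1 N                     ≡⟨ cong₂ _+_ (*-identityˡ (shifted-central 1 N)) (*-identityˡ (shifted-central 1 N)) ⟨
        1ℚ * shifted-central 1 N + 1ℚ * shifted-central 1 N           ≡⟨ *-distribʳ-+ (shifted-central 1 N) 1ℚ 1ℚ ⟨
        fromℕ 2 * shifted-central 1 N                                 ≡⟨ shifted-central-edge N ⟨
        shifted-central 0 (suc N)                                     ∎
        where open ≡-Reasoning

    central-zero : central 0 ≈ₚ 1ₚ +ₚ (u *ₚ central 1 +ₚ u *ₚ central 1)
    central-zero = begin
      central 0                                                  ≈⟨ ∑ₚ-head (central-term 0) (central-term-summable 0) ⟩
      central-term 0 0 +ₚ ∑ₚ (central-term 0 ∘ suc)              ≈⟨ +ₚ-cong (*ₚ-identityˡ 1ₚ) (∑ₚ-cong doubled) ⟩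
      1ₚ +ₚ ∑ₚ (λ N → f N +ₚ f N)                                ≈⟨ +ₚ-cong (≈ₚ-refl {1ₚ}) (∑ₚ-distrib-+ₚ f f) ⟩
      1ₚ +ₚ (∑ₚ f +ₚ ∑ₚ f)                                       ≈⟨ +ₚ-cong (≈ₚ-refl {1ₚ}) (+ₚ-cong (u-*ₚ-central 1) (u-*ₚ-central 1)) ⟨
      1ₚ +ₚ (u *ₚ central 1 +ₚ u *ₚ central 1)                   ∎
      where
      open ≈ₚ-Reasoning
      f : ℕ → PS
      f N = constₚ (shifted-central 1 N) *ₚ u ^ₚ suc (2 ℕ.* N ℕ.+ 1)
      doubled : ∀ N → central-term 0 (suc N) ≈ₚ f N +ₚ f N
      doubled N = ≈ₚ-sym (≈ₚ-trans (scaled-power-+ (shifted-central 1 N) (shifted-central 1 N) (suc (2 ℕ.* N ℕ.+ 1)))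
                                   (scaled-power-cong (suc (2 ℕ.* N ℕ.+ 1)) (shifted-central-doubled N) (size N)))
        where
        size : ∀ N → suc (2 ℕ.* N ℕ.+ 1) ≡ 2 ℕ.* suc N ℕ.+ 0
        size = ℕ-Solver.solve-∀


module ExplicitLevels where

  open import Defs
  open PowerSeries
  open Reciprocal
  open SeriesSums
  open GrandSeries
  open HeightSystem
  open CentralSeries
  open import Data.Nat using (ℕ; zero; suc; s≤s)
  open import Data.Rational using (0ℚ; 1ℚ; _+_)
  open import Data.Rational.Properties
  open import Data.Fin using (Fin)
  open import Data.Product using (_,_)
  open import Function.Bundles using (_↔_)
  open import Relation.Binary.PropositionalEquality
  open PS-Solver using (solve; _:+_; _:*_; _:-_; con; _:=_)

  module _ (k : ℕ) where

    1-Fib : PS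
    1-Fib = 1ₚ -ₚ Fib k

    -- Y = 1/(1 − Fib) and u = zY are the series of horizontal runs and of runs followed by a step.
    Y u : PS
    Y = invₚ 1-Fib
    u = zₚ *ₚ Y

    1-Fib-*ₚ-Y : 1-Fib *ₚ Y ≈ₚ 1ₚ
    1-Fib-*ₚ-Y = invₚ-inverseʳ 1-Fib λ ()

    u-order : OrderAtLeast 1 u
    u-order zero _ = zₚ-*ₚ-zero Y
    u-order (suc t) (s≤s ())

    explicit-levels : ℕ → PS
    explicit-levels j = Y *ₚ central u u-order j

    explicit-levels-system : HeightSystem k explicit-levels
    explicit-levels-system = level-zero , level-suc
      where
      C : ℕ → PS
      C = central u u-order
      r : PS
      r = 1-Fib *ₚ Y -ₚ 1ₚ
      r≈0 : r ≈ₚ 0ₚ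
      r≈0 = -ₚ-≈0ₚ 1-Fib-*ₚ-Y
      level-zero : explicit-levels 0 ≈ₚ 1ₚ +ₚ (zₚ *ₚ explicit-levels 1 +ₚ (zₚ *ₚ explicit-levels 1 +ₚ Fib k *ₚ explicit-levels 0))
      level-zero = ≈ₚ-modulo
        (solve 5 (λ y z h c₀ c₁ → y :* c₀ :=
          con 1ℚ :+ (z :* (y :* c₁) :+ (z :* (y :* c₁) :+ h :* (y :* c₀))) :+
          (((con 1ℚ :- h) :* y :- con 1ℚ) :* c₀ :+ (c₀ :- (con 1ℚ :+ ((z :* y) :* c₁ :+ (z :* y) :* c₁)))))
          (λ _ → refl) Y zₚ (Fib k) (C 0) (C 1))
        (λ n → trans (cong₂ _+_ (≈0ₚ-*ₚ r≈0 (C 0) n) (-ₚ-≈0ₚ (central-zero u u-order) n)) (+-identityˡ 0ℚ))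
      level-suc : ∀ j → explicit-levels (suc j) ≈ₚ zₚ *ₚ explicit-levels j +ₚ (zₚ *ₚ explicit-levels (suc (suc j)) +ₚ Fib k *ₚ explicit-levels (suc j))
      level-suc j = ≈ₚ-modulo
        (solve 6 (λ y z h c₀ c₁ c₂ → y :* c₁ :=
          z :* (y :* c₀) :+ (z :* (y :* c₂) :+ h :* (y :* c₁)) :+
          (((con 1ℚ :- h) :* y :- con 1ℚ) :* c₁ :+ (c₁ :- ((z :* y) :* c₀ :+ (z :* y) :* c₂))))
          (λ _ → refl) Y zₚ (Fib k) (C j) (C (suc j)) (C (suc (suc j))))
        (λ n → trans (cong₂ _+_ (≈0ₚ-*ₚ r≈0 (C (suc j)) n) (-ₚ-≈0ₚ (central-suc u u-order j) n)) (+-identityˡ 0ℚ))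

    card≈explicit-level-zero : (card : ℕ → ℕ) → (∀ i → GrandPath k i ↔ Fin (card i)) → ∀ i → fromℕ (card i) ≡ explicit-levels 0 i
    card≈explicit-level-zero = HeightSystem⇒card k explicit-levels explicit-levels-system


module Expansion where

  open import Defs
  open FiniteSums
  open PowerSeries
  open Reciprocal
  open SeriesSums
  open Binomials
  open GrandSeries
  open import Data.Nat as ℕ using (ℕ; zero; suc; s≤s)
  import Data.Nat.Properties as ℕₚ
  open import Data.Nat.Combinatorics using (nCn≡1)
  open import Data.Rational using (ℚ; 0ℚ; 1ℚ; _+_; _*_; _-_; -_)
  open import Data.Rational.Properties
  open import Function using (_∘_)
  open import Relation.Nullary using (¬_)
  open import Relation.Binary.PropositionalEquality
  open import Tactic.RingSolver using (solve-∀)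
  open PS-Solver using (solve; _:*_; _:-_; con; _:=_)

  power-terms : PS → (ℕ → ℚ) → ℕ → PS
  power-terms h c l = constₚ (c l) *ₚ h ^ₚ l

  power-series : PS → (ℕ → ℚ) → PS
  power-series h c = ∑ₚ (power-terms h c)

  difference : (ℕ → ℚ) → ℕ → ℚ
  difference c zero = c 0
  difference c (suc l) = c (suc l) - c l

  negative-binomial : ℕ → ℕ → ℚ
  negative-binomial K l = binomial (K ℕ.+ l) l

  module _ (h : PS) (h-order : OrderAtLeast 1 h) where

    power-terms-summable : ∀ c → Summable (power-terms h c)
    power-terms-summable c l = OrderAtLeast-*ₚˡ (constₚ (c l)) (OrderAtLeast-^ₚ h-order l)

    1-h-*ₚ-power-series : ∀ c → (1ₚ -ₚ h) *ₚ power-series h c ≈ₚ power-series h (difference c)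
    1-h-*ₚ-power-series c t = begin
      ((1ₚ -ₚ h) *ₚ power-series h c) t
        ≡⟨ solve 2 (λ x s → (con 1ℚ :- x) :* s := s :- x :* s) (λ _ → refl) h (power-series h c) t ⟩
      power-series h c t - (h *ₚ power-series h c) t
        ≡⟨ cong₂ _-_ (∑ₚ-head (power-terms h c) (power-terms-summable c) t)
                     (trans (*ₚ-distribˡ-∑ₚ h (power-terms h c) (power-terms-summable c) t) (∑ₚ-cong raise t)) ⟩
      (a₀ + sumTo t (λ l → term (c (suc l)) l)) - sumTo t (λ l → term (c l) l)
        ≡⟨ regroup a₀ _ _ ⟩
      a₀ + (sumTo t (λ l → term (c (suc l)) l) + - sumTo t (λ l → term (c l) l))
        ≡⟨ cong (λ x → a₀ + (sumTo t (λ l → term (c (suc l)) l) + x)) (neg-distrib-sumTo t _) ⟩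
      a₀ + (sumTo t (λ l → term (c (suc l)) l) + sumTo t (λ l → - term (c l) l))
        ≡⟨ cong (a₀ +_) (sumTo-distrib-+ t _ _) ⟨
      a₀ + sumTo t (λ l → term (c (suc l)) l + - term (c l) l)
        ≡⟨ cong (a₀ +_) (sumTo-cong t (λ l → subtract (c (suc l)) (c l) l)) ⟩
      a₀ + sumTo t (λ l → term (difference c (suc l)) l)
        ≡⟨ ∑ₚ-head (power-terms h (difference c)) (power-terms-summable (difference c)) t ⟨
      power-series h (difference c) t ∎
      where
      open ≡-Reasoning
      term : ℚ → ℕ → ℚ
      term a l = (constₚ a *ₚ h ^ₚ suc l) t
      a₀ = (constₚ (c 0) *ₚ h ^ₚ 0) t
      raise : ∀ l → h *ₚ (constₚ (c l) *ₚ h ^ₚ l) ≈ₚ constₚ (c l) *ₚ h ^ₚ suc l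
      raise l = solve 3 (λ x a p → x :* (a :* p) := a :* (x :* p)) (λ _ → refl) h (constₚ (c l)) (h ^ₚ l)
      regroup : ∀ a b c → (a + b) - c ≡ a + (b + - c)
      regroup = solve-∀ ℚ-ring
      subtract : ∀ a b l → term a l + - term b l ≡ term (a - b) l
      subtract a b l = begin
        term a l + - term b l                        ≡⟨ cong₂ (λ x y → x + - y) (constₚ-*ₚ a (h ^ₚ suc l) t) (constₚ-*ₚ b (h ^ₚ suc l) t) ⟩
        a * (h ^ₚ suc l) t + - (b * (h ^ₚ suc l) t)  ≡⟨ factor a b ((h ^ₚ suc l) t) ⟩
        (a - b) * (h ^ₚ suc l) t                     ≡⟨ constₚ-*ₚ (a - b) (h ^ₚ suc l) t ⟨
        term (a - b) l                               ∎
        where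
        factor : ∀ a b x → a * x + - (b * x) ≡ (a - b) * x
        factor = solve-∀ ℚ-ring

    private
      difference-negative-binomial : ∀ K l → difference (negative-binomial (suc K)) l ≡ negative-binomial K l
      difference-negative-binomial K zero = refl
      difference-negative-binomial K (suc l) = begin
        binomial (suc (K ℕ.+ suc l)) (suc l) - binomial (suc K ℕ.+ l) l
          ≡⟨ cong₂ _-_ (binomial-pascal (K ℕ.+ suc l) l) (cong (λ x → binomial x l) (sym (ℕₚ.+-suc K l))) ⟩
        (binomial (K ℕ.+ suc l) l + binomial (K ℕ.+ suc l) (suc l)) - binomial (K ℕ.+ suc l) l
          ≡⟨ cancel (binomial (K ℕ.+ suc l) l) (binomial (K ℕ.+ suc l) (suc l)) ⟩
        binomial (K ℕ.+ suc l) (suc l) ∎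
        where
        open ≡-Reasoning
        cancel : ∀ a b → (a + b) - a ≡ b
        cancel = solve-∀ ℚ-ring

      difference-zero : ∀ l → difference (negative-binomial 0) (suc l) ≡ 0ℚ
      difference-zero l = trans (cong₂ (λ x y → fromℕ x - fromℕ y) (nCn≡1 (suc l)) (nCn≡1 l)) (+-inverseʳ 1ℚ)

      1-h-*ₚ-power-series-suc : ∀ K → (1ₚ -ₚ h) *ₚ power-series h (negative-binomial (suc K)) ≈ₚ power-series h (negative-binomial K)
      1-h-*ₚ-power-series-suc K = ≈ₚ-trans (1-h-*ₚ-power-series _)
        (∑ₚ-cong (λ l n → cong (λ a → (constₚ a *ₚ h ^ₚ l) n) (difference-negative-binomial K l)))

      1-h-*ₚ-power-series-zero : (1ₚ -ₚ h) *ₚ power-series h (negative-binomial 0) ≈ₚ 1ₚ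
      1-h-*ₚ-power-series-zero = begin
        (1ₚ -ₚ h) *ₚ power-series h (negative-binomial 0)    ≈⟨ 1-h-*ₚ-power-series _ ⟩
        power-series h (difference (negative-binomial 0))      ≈⟨ ∑ₚ-head _ (power-terms-summable _) ⟩
        power-terms h (difference (negative-binomial 0)) 0 +ₚ ∑ₚ (power-terms h (difference (negative-binomial 0)) ∘ suc)
                                                             ≈⟨ +ₚ-cong (*ₚ-identityˡ 1ₚ) higher-vanish ⟩
        1ₚ +ₚ 0ₚ                                             ≈⟨ (λ n → +-identityʳ (1ₚ n)) ⟩
        1ₚ                                                   ∎
        where
        open ≈ₚ-Reasoning
        higher-vanish : ∑ₚ (power-terms h (difference (negative-binomial 0)) ∘ suc) ≈ₚ 0ₚ
        higher-vanish t = sumTo-zero t _ (λ l _ → trans (constₚ-*ₚ _ (h ^ₚ suc l) t)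
          (trans (cong (_* (h ^ₚ suc l) t) (difference-zero l)) (*-zeroˡ ((h ^ₚ suc l) t))))

    1-h-^-*ₚ-power-series : ∀ K → (1ₚ -ₚ h) ^ₚ suc K *ₚ power-series h (negative-binomial K) ≈ₚ 1ₚ
    1-h-^-*ₚ-power-series zero = ≈ₚ-trans (*ₚ-congʳ (power-series h (negative-binomial 0)) (*ₚ-identityʳ (1ₚ -ₚ h))) 1-h-*ₚ-power-series-zero
    1-h-^-*ₚ-power-series (suc K) = begin
      ((1ₚ -ₚ h) *ₚ (1ₚ -ₚ h) ^ₚ suc K) *ₚ power-series h (negative-binomial (suc K))
        ≈⟨ solve 3 (λ a p s → (a :* p) :* s := p :* (a :* s)) (λ _ → refl) (1ₚ -ₚ h) ((1ₚ -ₚ h) ^ₚ suc K) (power-series h (negative-binomial (suc K))) ⟩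
      (1ₚ -ₚ h) ^ₚ suc K *ₚ ((1ₚ -ₚ h) *ₚ power-series h (negative-binomial (suc K)))
        ≈⟨ *ₚ-congˡ ((1ₚ -ₚ h) ^ₚ suc K) (1-h-*ₚ-power-series-suc K) ⟩
      (1ₚ -ₚ h) ^ₚ suc K *ₚ power-series h (negative-binomial K)
        ≈⟨ 1-h-^-*ₚ-power-series K ⟩
      1ₚ ∎
      where open ≈ₚ-Reasoning

    invₚ-1-h-^ : ∀ K → invₚ (1ₚ -ₚ h) ^ₚ suc K ≈ₚ power-series h (negative-binomial K)
    invₚ-1-h-^ K = ≈ₚ-trans
      (invₚ-unique A (invₚ (1ₚ -ₚ h) ^ₚ suc K) A-head≢0 (^ₚ-inverse (1ₚ -ₚ h) (invₚ (1ₚ -ₚ h)) (invₚ-inverseʳ (1ₚ -ₚ h) h-head≢0) (suc K)))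
      (≈ₚ-sym (invₚ-unique A (power-series h (negative-binomial K)) A-head≢0 (1-h-^-*ₚ-power-series K)))
      where
      A : PS
      A = (1ₚ -ₚ h) ^ₚ suc K
      1-h-head : (1ₚ -ₚ h) 0 ≡ 1ℚ
      1-h-head = trans (cong (λ x → 1ℚ - x) (h-order 0 (s≤s ℕ.z≤n))) (+-identityʳ 1ℚ)
      h-head≢0 : ¬ ((1ₚ -ₚ h) 0 ≡ 0ℚ)
      h-head≢0 eq = 1≢0 (trans (sym 1-h-head) eq)
      A-head≢0 : ¬ (A 0 ≡ 0ℚ)
      A-head≢0 eq = 1≢0 (trans (sym (^ₚ-head (1ₚ -ₚ h) 1-h-head (suc K))) eq)


module Coefficients where

  open import Defs
  open FiniteSums
  open PowerSeries
  open Reciprocal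
  open SeriesSums
  open NatCast
  open Binomials
  open GrandSeries
  open CentralSeries
  open Expansion
  open ExplicitLevels
  open import Data.Nat as ℕ using (ℕ; zero; suc; _≤_; _<_; s≤s; _∸_)
  import Data.Nat.Properties as ℕₚ
  open import Data.Nat.Combinatorics using (_C_)
  import Data.Nat.Tactic.RingSolver as ℕ-Solver
  open import Data.Integer as ℤ using ()
  open import Data.Rational using (ℚ; 0ℚ; 1ℚ; _+_; _*_; _-_; -_; _/_)
  open import Data.Bool using (true; false; if_then_else_; T)
  open import Data.Rational.Properties
  open import Function using (_∘_)
  open import Relation.Binary.PropositionalEquality
  open import Tactic.RingSolver using (solve-∀)
  open PS-Solver using (solve; _:+_; _:*_; _:-_; :-_; con; _:=_)

  module _ (k : ℕ) where

    private
      P Q : PS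
      P = Pk k
      Q = Pk (suc k)

    private
      -- 1 − Fib = (P − z)/P = Q/P, hence Y = P/Q = 1 + z/Q.
      1-Fib-*ₚ-[1+z/Q] : 1-Fib k *ₚ (1ₚ +ₚ zₚ *ₚ invₚ Q) ≈ₚ 1ₚ
      1-Fib-*ₚ-[1+z/Q] = ≈ₚ-modulo lhs≈1+residual residual≈0
        where
        κ κ′ lhs x ρ₁ ρ₂ ρ₃ ρ₄ b₁ b₂ b₃ b₄ residual : PS
        κ = constₚ (fromℕ k)
        κ′ = constₚ (fromℕ (suc k))
        lhs = 1-Fib k *ₚ (1ₚ +ₚ zₚ *ₚ invₚ Q)
        x = lhs -ₚ 1ₚ
        ρ₁ = Fib k *ₚ P -ₚ zₚ
        ρ₂ = Q *ₚ invₚ Q -ₚ 1ₚ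
        ρ₃ = κ′ -ₚ (1ₚ +ₚ κ)
        ρ₄ = P *ₚ invₚ P -ₚ 1ₚ
        b₁ = negₚ (invₚ P *ₚ (1ₚ +ₚ zₚ *ₚ invₚ Q))
        b₂ = invₚ P *ₚ zₚ
        b₃ = invₚ P *ₚ (zₚ *ₚ (zₚ *ₚ invₚ Q))
        b₄ = negₚ x
        residual = ρ₂ *ₚ b₂ +ₚ ρ₃ *ₚ b₃ +ₚ ρ₁ *ₚ b₁ +ₚ ρ₄ *ₚ b₄
        in-ideal : x ≈ₚ residual
        in-ideal = solve 6 (λ h c c′ z iP iQ →
            let p = con 1ℚ :- c :* z :- z :* z
                q = con 1ℚ :- c′ :* z :- z :* z
                x = (con 1ℚ :- h) :* (con 1ℚ :+ z :* iQ) :- con 1ℚ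
                r₁ = h :* p :- z
                r₂ = q :* iQ :- con 1ℚ
                r₃ = c′ :- (con 1ℚ :+ c)
                r₄ = p :* iP :- con 1ℚ
            in x := r₂ :* (iP :* z) :+ r₃ :* (iP :* (z :* (z :* iQ))) :+ r₁ :* (:- (iP :* (con 1ℚ :+ z :* iQ))) :+ r₄ :* (:- x))
          (λ _ → refl) (Fib k) κ κ′ zₚ (invₚ P) (invₚ Q)
        residual≈0 : residual ≈ₚ 0ₚ
        residual≈0 n = cong₂ _+_ (cong₂ _+_ (cong₂ _+_
          (≈0ₚ-*ₚ (-ₚ-≈0ₚ (invₚ-inverseʳ Q (Pk-head≢0 (suc k)))) b₂ n)
          (≈0ₚ-*ₚ (-ₚ-≈0ₚ (constₚ-fromℕ-suc k)) b₃ n))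
          (≈0ₚ-*ₚ (-ₚ-≈0ₚ (Fib-*ₚ-Pk k)) b₁ n))
          (≈0ₚ-*ₚ (-ₚ-≈0ₚ (invₚ-inverseʳ P (Pk-head≢0 k))) b₄ n)
        lhs≈1+residual : lhs ≈ₚ 1ₚ +ₚ residual
        lhs≈1+residual n = trans (shift (lhs n) (1ₚ n)) (cong (1ₚ n +_) (in-ideal n))
          where
          shift : ∀ a b → a ≡ b + (a - b)
          shift = solve-∀ ℚ-ring

    Y≈1+z/Q : Y k ≈ₚ 1ₚ +ₚ zₚ *ₚ invₚ Q
    Y≈1+z/Q = ≈ₚ-sym (invₚ-unique (1-Fib k) (1ₚ +ₚ zₚ *ₚ invₚ Q) (λ ()) 1-Fib-*ₚ-[1+z/Q])

    Y-suc : ∀ t → Y k (suc t) ≡ convF (suc k) 1 (suc t)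
    Y-suc t = begin
      Y k (suc t)                       ≡⟨ Y≈1+z/Q (suc t) ⟩
      0ℚ + (zₚ *ₚ invₚ Q) (suc t)       ≡⟨ +-identityˡ _ ⟩
      (zₚ *ₚ invₚ Q) (suc t)            ≡⟨ zₚ-*ₚ-suc (invₚ Q) t ⟩
      invₚ Q t                          ≡⟨ *ₚ-identityʳ (invₚ Q) t ⟨
      convF (suc k) 1 (suc t)           ∎
      where open ≡-Reasoning

    private
      Fib-order : OrderAtLeast 1 (Fib k)
      Fib-order zero _ = refl
      Fib-order (suc t) (s≤s ())

    u^-*ₚ-Y : ∀ m → u k ^ₚ m *ₚ Y k ≈ₚ zₚ ^ₚ m *ₚ Y k ^ₚ suc m
    u^-*ₚ-Y m = begin
      u k ^ₚ m *ₚ Y k                   ≈⟨ *ₚ-congʳ (Y k) (^ₚ-distrib-*ₚ zₚ (Y k) m) ⟩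
      (zₚ ^ₚ m *ₚ Y k ^ₚ m) *ₚ Y k      ≈⟨ solve 3 (λ a b y → (a :* b) :* y := a :* (y :* b)) (λ _ → refl) (zₚ ^ₚ m) (Y k ^ₚ m) (Y k) ⟩
      zₚ ^ₚ m *ₚ Y k ^ₚ suc m           ∎
      where open ≈ₚ-Reasoning

    Fib^-coeff : ∀ l s → l ≤ s → (Fib k ^ₚ l) s ≡ (invₚ P ^ₚ l) (s ∸ l)
    Fib^-coeff l s l≤s = begin
      (Fib k ^ₚ l) s                      ≡⟨ ^ₚ-cong (Fib≈z/Pk k) l s ⟩
      ((zₚ *ₚ invₚ P) ^ₚ l) s             ≡⟨ ^ₚ-distrib-*ₚ zₚ (invₚ P) l s ⟩
      (zₚ ^ₚ l *ₚ invₚ P ^ₚ l) s          ≡⟨ zₚ^-*ₚ-≥ l (invₚ P ^ₚ l) s l≤s ⟩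
      (invₚ P ^ₚ l) (s ∸ l)               ∎
      where open ≡-Reasoning

    u^-*ₚ-Y-≥ : ∀ m t → m ≤ t → (u k ^ₚ m *ₚ Y k) t ≡ sumTo (t ∸ m) (λ l → negative-binomial m l * (invₚ P ^ₚ l) ((t ∸ m) ∸ l))
    u^-*ₚ-Y-≥ m t m≤t = begin
      (u k ^ₚ m *ₚ Y k) t                          ≡⟨ u^-*ₚ-Y m t ⟩
      (zₚ ^ₚ m *ₚ Y k ^ₚ suc m) t                  ≡⟨ zₚ^-*ₚ-≥ m (Y k ^ₚ suc m) t m≤t ⟩
      (Y k ^ₚ suc m) (t ∸ m)                       ≡⟨ invₚ-1-h-^ (Fib k) Fib-order m (t ∸ m) ⟩
      power-series (Fib k) (negative-binomial m) (t ∸ m)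
        ≡⟨ sumTo-cong-≤ (t ∸ m) (λ l l≤ → trans (constₚ-*ₚ _ (Fib k ^ₚ l) (t ∸ m)) (cong (negative-binomial m l *_) (Fib^-coeff l (t ∸ m) l≤))) ⟩
      sumTo (t ∸ m) (λ l → negative-binomial m l * (invₚ P ^ₚ l) ((t ∸ m) ∸ l)) ∎
      where open ≡-Reasoning

    u^-*ₚ-Y-< : ∀ m t → t < m → (u k ^ₚ m *ₚ Y k) t ≡ 0ℚ
    u^-*ₚ-Y-< m t t<m = trans (u^-*ₚ-Y m t) (zₚ^-*ₚ-< m (Y k ^ₚ suc m) t t<m)

    ballot-term : ℕ → ℕ → ℕ → ℚ
    ballot-term t n m = fromℕ (2 ℕ.^ n) * ballot (n ℕ.+ 0) m * (u k ^ₚ (2 ℕ.* (n ℕ.+ m) ℕ.+ 0) *ₚ Y k) t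

    private
      ballot-term-vanishes : ∀ t n m → t < n ℕ.+ m → ballot-term t n m ≡ 0ℚ
      ballot-term-vanishes t n m t<n+m = trans
        (cong (fromℕ (2 ℕ.^ n) * ballot (n ℕ.+ 0) m *_) (u^-*ₚ-Y-< _ t (ℕₚ.<-≤-trans t<n+m n+m≤exponent)))
        (*-zeroʳ (fromℕ (2 ℕ.^ n) * ballot (n ℕ.+ 0) m))
        where
        n+m≤exponent : n ℕ.+ m ≤ 2 ℕ.* (n ℕ.+ m) ℕ.+ 0
        n+m≤exponent = ℕₚ.≤-trans (ℕₚ.m≤m+n (n ℕ.+ m) (n ℕ.+ m ℕ.+ 0)) (ℕₚ.m≤m+n _ 0)

    explicit-level-zero-coeff : ∀ t → explicit-levels k 0 t ≡ sumTo t (λ n → sumTo t (ballot-term t n))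
    explicit-level-zero-coeff t = begin
      explicit-levels k 0 t
        ≡⟨ *ₚ-distribˡ-∑ₚ (Y k) _ (central-term-summable (u k) (u-order k) 0) t ⟩
      sumTo t (λ N → (Y k *ₚ central-term (u k) (u-order k) 0 N) t)
        ≡⟨ sumTo-cong t (λ N → trans (rearrange N t) (constₚ-*ₚ (shifted-central 0 N) (power N) t)) ⟩
      sumTo t (λ N → shifted-central 0 N * power N t)
        ≡⟨ sumTo-cong t (λ N → cong (_* power N t) (sym (ballot-sum≡shifted-central 0 N))) ⟩
      sumTo t (λ N → ballot-sum 0 N * power N t)
        ≡⟨ sumTo-cong t (λ N → *-distribʳ-sumTo N (power N t) _) ⟩
      sumTo t (λ N → sumTo N (λ n → fromℕ (2 ℕ.^ n) * ballot (n ℕ.+ 0) (N ∸ n) * power N t))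
        ≡⟨ sumTo-cong t (λ N → sumTo-cong-≤ N (λ n n≤N →
             cong (λ x → fromℕ (2 ℕ.^ n) * ballot (n ℕ.+ 0) (N ∸ n) * power x t) (sym (ℕₚ.m+[n∸m]≡n n≤N)))) ⟩
      sumTo t (λ N → sumTo N (λ n → ballot-term t n (N ∸ n)))
        ≡⟨ sumTo-triangle t (ballot-term t) ⟩
      sumTo t (λ n → sumTo (t ∸ n) (ballot-term t n))
        ≡⟨ sumTo-cong-≤ t (λ n n≤t → sumTo-extend (t ∸ n) t (ballot-term t n) (ℕₚ.m∸n≤m t n)
             (λ m t∸n<m _ → ballot-term-vanishes t n m (beyond n m n≤t t∸n<m))) ⟩
      sumTo t (λ n → sumTo t (ballot-term t n)) ∎
      where
      open ≡-Reasoning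
      power : ℕ → PS
      power N = u k ^ₚ (2 ℕ.* N ℕ.+ 0) *ₚ Y k
      rearrange : ∀ N → Y k *ₚ central-term (u k) (u-order k) 0 N ≈ₚ constₚ (shifted-central 0 N) *ₚ power N
      rearrange N = solve 3 (λ y c p → y :* (c :* p) := c :* (p :* y)) (λ _ → refl) (Y k) (constₚ (shifted-central 0 N)) (u k ^ₚ (2 ℕ.* N ℕ.+ 0))
      beyond : ∀ n m → n ≤ t → t ∸ n < m → t < n ℕ.+ m
      beyond n m n≤t t∸n<m = ℕₚ.≤-<-trans (ℕₚ.≤-reflexive (sym (ℕₚ.m+[n∸m]≡n n≤t))) (ℕₚ.+-monoʳ-< n t∸n<m)

    ballot-terms-zero : ∀ t → sumTo (suc t) (ballot-term (suc t) 0) ≡ convF (suc k) 1 (suc t)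
    ballot-terms-zero t = begin
      sumTo (suc t) (ballot-term (suc t) 0)                       ≡⟨ sumTo-head t (ballot-term (suc t) 0) ⟩
      ballot-term (suc t) 0 0 + sumTo t (ballot-term (suc t) 0 ∘ suc) ≡⟨ cong₂ _+_ first rest ⟩
      convF (suc k) 1 (suc t) + 0ℚ                                ≡⟨ +-identityʳ _ ⟩
      convF (suc k) 1 (suc t)                                     ∎
      where
      open ≡-Reasoning
      first : ballot-term (suc t) 0 0 ≡ convF (suc k) 1 (suc t)
      first = begin
        1ℚ * 1ℚ * (1ₚ *ₚ Y k) (suc t)   ≡⟨ *-identityˡ _ ⟩
        (1ₚ *ₚ Y k) (suc t)             ≡⟨ *ₚ-identityˡ (Y k) (suc t) ⟩
        Y k (suc t)                     ≡⟨ Y-suc t ⟩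
        convF (suc k) 1 (suc t)         ∎
      rest : sumTo t (ballot-term (suc t) 0 ∘ suc) ≡ 0ℚ
      rest = sumTo-zero t _ (λ m _ → trans (cong (_* power m) (*-zeroʳ 1ℚ)) (*-zeroˡ (power m)))
        where
        power : ℕ → ℚ
        power m = (u k ^ₚ (2 ℕ.* (0 ℕ.+ suc m) ℕ.+ 0) *ₚ Y k) (suc t)

    -- The summand of coeffFormula for n = i + 1, and its sum over l.
    formula-term : ℕ → ℕ → ℕ → ℕ → ℚ
    formula-term t i m l =
      fromℕ (2 ℕ.^ suc i) * ((ℤ.+ suc i) / (suc i ℕ.+ 2 ℕ.* m)) * fromℕ ((suc i ℕ.+ 2 ℕ.* m) C m) *
      fromℕ ((l ℕ.+ 2 ℕ.* suc i ℕ.+ 2 ℕ.* m) C l) * convF k l (suc (t ∸ (2 ℕ.* suc i ℕ.+ 2 ℕ.* m ℕ.+ l)))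

    formula-inner : ℕ → ℕ → ℕ → ℚ
    formula-inner t i m =
      if (2 ℕ.* suc i ℕ.+ 2 ℕ.* m) ℕ.≤ᵇ t then sumTo (t ∸ (2 ℕ.* suc i ℕ.+ 2 ℕ.* m)) (formula-term t i m) else 0ℚ

    coeffFormula-suc : ∀ t → coeffFormula k (suc t) ≡ convF (suc k) 1 (suc t) + sumTo t (λ i → sumTo (suc t) (formula-inner (suc t) i))
    coeffFormula-suc t = refl

    private
      ballot-exponent : ∀ i m → 2 ℕ.* (suc i ℕ.+ m) ℕ.+ 0 ≡ 2 ℕ.* suc i ℕ.+ 2 ℕ.* m
      ballot-exponent = ℕ-Solver.solve-∀

    formula-inner≡ballot-term : ∀ t i m → formula-inner t i m ≡ ballot-term t (suc i) m
    formula-inner≡ballot-term t i m with (2 ℕ.* suc i ℕ.+ 2 ℕ.* m) ℕ.≤ᵇ t in fits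
    ... | true = begin
      sumTo (t ∸ e) (formula-term t i m)                      ≡⟨ sumTo-cong (t ∸ e) (λ l → *-assoc c (b l) (v l)) ⟩
      sumTo (t ∸ e) (λ l → c * (b l * v l))                   ≡⟨ *-distribˡ-sumTo (t ∸ e) c _ ⟨
      c * sumTo (t ∸ e) (λ l → b l * v l)                     ≡⟨ cong₂ _*_ closed-form (sym power-coeff) ⟩
      ballot-term t (suc i) m                                  ∎
      where
      open ≡-Reasoning
      e = 2 ℕ.* suc i ℕ.+ 2 ℕ.* m
      c = fromℕ (2 ℕ.^ suc i) * ((ℤ.+ suc i) / (suc i ℕ.+ 2 ℕ.* m)) * fromℕ ((suc i ℕ.+ 2 ℕ.* m) C m)
      b : ℕ → ℚ
      b l = fromℕ ((l ℕ.+ 2 ℕ.* suc i ℕ.+ 2 ℕ.* m) C l)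
      v : ℕ → ℚ
      v l = convF k l (suc (t ∸ (2 ℕ.* suc i ℕ.+ 2 ℕ.* m ℕ.+ l)))
      exponent : 2 ℕ.* (suc i ℕ.+ m) ℕ.+ 0 ≡ e
      exponent = ballot-exponent i m
      closed-form : c ≡ fromℕ (2 ℕ.^ suc i) * ballot (suc i ℕ.+ 0) m
      closed-form = trans (*-assoc (fromℕ (2 ℕ.^ suc i)) _ _)
        (cong (fromℕ (2 ℕ.^ suc i) *_) (trans (ballot-closed-form i m) (cong (λ x → ballot x m) (sym (ℕₚ.+-identityʳ (suc i))))))
      power-coeff : (u k ^ₚ (2 ℕ.* (suc i ℕ.+ m) ℕ.+ 0) *ₚ Y k) t ≡ sumTo (t ∸ e) (λ l → b l * v l)
      power-coeff = begin
        (u k ^ₚ (2 ℕ.* (suc i ℕ.+ m) ℕ.+ 0) *ₚ Y k) t  ≡⟨ cong (λ x → (u k ^ₚ x *ₚ Y k) t) exponent ⟩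
        (u k ^ₚ e *ₚ Y k) t                              ≡⟨ u^-*ₚ-Y-≥ e t (ℕₚ.≤ᵇ⇒≤ e t (subst T (sym fits) _)) ⟩
        sumTo (t ∸ e) (λ l → negative-binomial e l * (invₚ P ^ₚ l) ((t ∸ e) ∸ l))
          ≡⟨ sumTo-cong (t ∸ e) (λ l → cong₂ _*_
               (cong (λ x → fromℕ (x C l)) (trans (ℕₚ.+-comm e l) (sym (ℕₚ.+-assoc l (2 ℕ.* suc i) (2 ℕ.* m)))))
               (cong (invₚ P ^ₚ l) (ℕₚ.∸-+-assoc t e l))) ⟩
        sumTo (t ∸ e) (λ l → b l * v l)                  ∎
    ... | false = sym (trans (cong (c *_) (u^-*ₚ-Y-< _ t too-short)) (*-zeroʳ c))
      where
      c : ℚ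
      c = fromℕ (2 ℕ.^ suc i) * ballot (suc i ℕ.+ 0) m
      e = 2 ℕ.* suc i ℕ.+ 2 ℕ.* m
      exponent : 2 ℕ.* (suc i ℕ.+ m) ℕ.+ 0 ≡ e
      exponent = ballot-exponent i m
      too-short : t < 2 ℕ.* (suc i ℕ.+ m) ℕ.+ 0
      too-short = subst (t <_) (sym exponent) (ℕₚ.≰⇒> (λ e≤t → subst T fits (ℕₚ.≤⇒≤ᵇ e≤t)))

    coefficient-formula : ∀ t → 1 ≤ t → explicit-levels k 0 t ≡ coeffFormula k t
    coefficient-formula (suc t) _ = begin
      explicit-levels k 0 (suc t)
        ≡⟨ explicit-level-zero-coeff (suc t) ⟩
      sumTo (suc t) (λ n → sumTo (suc t) (ballot-term (suc t) n))
        ≡⟨ sumTo-head t _ ⟩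
      sumTo (suc t) (ballot-term (suc t) 0) + sumTo t (λ i → sumTo (suc t) (ballot-term (suc t) (suc i)))
        ≡⟨ cong₂ _+_ (ballot-terms-zero t) (sumTo-cong t (λ i → sumTo-cong (suc t) (λ m → sym (formula-inner≡ballot-term (suc t) i m)))) ⟩
      convF (suc k) 1 (suc t) + sumTo t (λ i → sumTo (suc t) (formula-inner (suc t) i))
        ≡⟨ coeffFormula-suc t ⟨
      coeffFormula k (suc t) ∎
      where open ≡-Reasoning


open import Data.Product using (_,_)
open import Relation.Binary.PropositionalEquality using (trans)
open PowerSeries using (≈ₚ-sym; ≈ₚ-trans; *ₚ-congʳ)
open GrandSeries using (Grand)
open ClosedForm using (√Δ; √Δ-head; √Δ-squared; Grand-*ₚ-√Δ)
open ContinuedFraction using (ConvergesTo-respʳ; cfTrunc-converges)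
open GrandCount using (card≈Grand)
open ExplicitLevels using (card≈explicit-level-zero)
open Coefficients using (coefficient-formula)

-- The argument works for every k, including k = 0.
theorem3p7 : (k : ℕ) → 1 ≤ k →
    (card : ℕ → ℕ) → (∀ i → GrandPath k i ↔ Fin (card i)) →
    (∃[ S ] ((S 0 ≡ 1ℚ) × (S *ₚ S ≈ₚ Δk k) × ((λ i → fromℕ (card i)) *ₚ S ≈ₚ Pk k)))
    × ConvergesTo (cfTrunc k) (λ i → fromℕ (card i))
    × (∀ t → 1 ≤ t → fromℕ (card t) ≡ coeffFormula k t)
theorem3p7 k _ card card-iso =
  (√Δ k , √Δ-head k , √Δ-squared k , ≈ₚ-trans (*ₚ-congʳ (√Δ k) card≈T) (Grand-*ₚ-√Δ k)) ,
  ConvergesTo-respʳ (≈ₚ-sym card≈T) (cfTrunc-converges k) ,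
  λ t 1≤t → trans (card≈explicit-level-zero k card card-iso t) (coefficient-formula k t 1≤t)
  where
  card≈T : (λ i → fromℕ (card i)) ≈ₚ Grand k
  card≈T = card≈Grand k card card-iso
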